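{- Define polynomials $\overline{P}_n(x)$ by $\overline{P}_0(x)=1$ and, for $n\ge1$, \[\overline{P}_{n}(x)=\frac{x}{n}\sum_{k=1}^{n} \overline{\sigma}(k)\, \overline{P}_{n-k}(x),\] where for a positive integer $n=2^m l$ with $l$ odd, $\overline{\sigma}(n)=2^{m+1}\sigma(l)$ and $\sigma(l)=\sum_{d\mid l} d$. Then, as formal power series in $q$ (and for $|q|<1$), \[\sum_{n=0}^{\infty} \overline{P}_{n}(x)q^{n}=\Big(\prod_{n=1}^{\infty}\frac{1+q^n}{1-q^{n}}\Big)^x,\] and for every $n\ge1$ the derivative of $\overline{P}_n(x)$ satisfies \[\overline{P}_{n}^{\prime}(x)=\sum_{k=1}^{n} \frac{\overline{\sigma}(k)}{k}\, \overline{P}_{n-k}(x).\] -}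

module Defs where

open import Data.Nat as ℕ using (ℕ; zero; suc; _∸_)
open import Data.Nat.Divisibility using (_∣?_)
open import Data.Nat.ListAction using (sum)
open import Data.Integer as ℤ using (+_)
open import Data.Rational as ℚ using (ℚ; 0ℚ; 1ℚ) renaming (_+_ to _+q_; _*_ to _*q_; -_ to -q_)
open import Data.List as List using (List; []; _∷_; [_]; _++_; upTo; applyUpTo; filter)
open import Data.Bool using (if_then_else_)
open import Data.Product using (_×_; _,_; proj₁; proj₂)
open import Relation.Nullary using (does)
open import Relation.Binary.PropositionalEquality using (_≡_)

σ : ℕ → ℕ
σ l = sum (filter (_∣? l) (applyUpTo suc l))

-- 2-adic decomposition n = 2^m · l, l odd (for n ≥ 1), computed with fuel
-- (fuel n is always sufficient since m ≤ n).
split2 : ℕ → ℕ → ℕ × ℕ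
split2 zero n = 0 , n
split2 (suc fuel) zero = 0 , zero
split2 (suc fuel) (suc n) with ℕ._≟_ (ℕ._%_ (suc n) 2) 0
... | Relation.Nullary.yes _ = let r = split2 fuel (ℕ._/_ (suc n) 2) in suc (proj₁ r) , proj₂ r
... | Relation.Nullary.no _ = 0 , suc n

twoExp : ℕ → ℕ
twoExp n = proj₁ (split2 n n)

oddPart : ℕ → ℕ
oddPart n = proj₂ (split2 n n)

σbar : ℕ → ℕ
σbar n = 2 ℕ.^ suc (twoExp n) ℕ.* σ (oddPart n)

-- σ̄(k)/k as a rational number (only used for k ≥ 1; value at 0 irrelevant)
σbarOver : ℕ → ℚ
σbarOver zero = 0ℚ
σbarOver (suc j) = + σbar (suc j) ℚ./ suc j

-- Polynomials in x over ℚ: coefficient lists, lowest degree first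

Poly : Set
Poly = List ℚ

coeff : Poly → ℕ → ℚ
coeff [] _ = 0ℚ
coeff (a ∷ p) zero = a
coeff (a ∷ p) (suc i) = coeff p i

infix 4 _≈P_
_≈P_ : Poly → Poly → Set
p ≈P q = ∀ i → coeff p i ≡ coeff q i

0P : Poly
0P = []

1P : Poly
1P = [ 1ℚ ]

constP : ℚ → Poly
constP c = [ c ]

X : Poly
X = 0ℚ ∷ 1ℚ ∷ []

infixl 6 _+P_
_+P_ : Poly → Poly → Poly
[] +P q = q
(a ∷ p) +P [] = a ∷ p
(a ∷ p) +P (b ∷ q) = (a +q b) ∷ (p +P q)

infixl 7 _·P_
_·P_ : ℚ → Poly → Poly
c ·P p = List.map (c *q_) p

negP : Poly → Poly
negP p = (-q 1ℚ) ·P p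

infixl 7 _*P_
_*P_ : Poly → Poly → Poly
[] *P q = []
(a ∷ p) *P q = (a ·P q) +P (0ℚ ∷ (p *P q))

sumP : List Poly → Poly
sumP = List.foldr _+P_ 0P

prodP : List Poly → Poly
prodP = List.foldr _*P_ 1P

derivAux : ℕ → Poly → Poly
derivAux k [] = []
derivAux k (a ∷ p) = ((+ k ℚ./ 1) *q a) ∷ derivAux (suc k) p

deriv : Poly → Poly
deriv [] = []
deriv (a ∷ p) = derivAux 1 p

sumFrom1 : ℕ → (ℕ → Poly) → Poly
sumFrom1 n f = sumP (applyUpTo (λ j → f (suc j)) n)

nth : List Poly → ℕ → Poly
nth [] _ = 0P
nth (a ∷ l) zero = a
nth (a ∷ l) (suc i) = nth l i

-- step n prev : value at n, given prev j (= value at j for j < n)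
table : ((n : ℕ) → (ℕ → Poly) → Poly) → ℕ → List Poly
table step zero = []
table step (suc n) = table step n ++ [ step n (nth (table step n)) ]

strongRec : ((n : ℕ) → (ℕ → Poly) → Poly) → ℕ → Poly
strongRec step n = nth (table step (suc n)) n

Pbar : ℕ → Poly
Pbar = strongRec step
  where
  step : (n : ℕ) → (ℕ → Poly) → Poly
  step zero prev = 1P
  step (suc n) prev =
    ((+ 1 ℚ./ suc n) ·P X) *P
      sumFrom1 (suc n) (λ k → (+ σbar k ℚ./ 1) ·P prev (suc n ∸ k))

-- Formal power series in q with coefficients in ℚ[x]

Series : Set
Series = ℕ → Poly

oneS : Series
oneS zero = 1P
oneS (suc _) = 0P

infixl 6 _+S_ _-S_
_+S_ : Series → Series → Series
(f +S g) n = f n +P g n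

_-S_ : Series → Series → Series
(f -S g) n = f n +P negP (g n)

infixl 7 _*S_
_*S_ : Series → Series → Series
(f *S g) n = sumP (List.map (λ i → f i *P g (n ∸ i)) (upTo (suc n)))

_^S_ : Series → ℕ → Series
f ^S zero = oneS
f ^S suc k = f *S (f ^S k)

qPow : ℕ → Series
qPow n j = if does (ℕ._≟_ j n) then 1P else 0P

-- multiplicative inverse of a series with constant term 1:
--   g_0 = 1, g_n = - Σ_{i=1}^{n} f_i g_{n-i}
invS : Series → Series
invS f = strongRec step
  where
  step : (n : ℕ) → (ℕ → Poly) → Poly
  step zero prev = 1P
  step (suc n) prev = negP (sumFrom1 (suc n) (λ i → f i *P prev (suc n ∸ i)))

prodUpTo : ℕ → Series
prodUpTo zero = oneS
prodUpTo (suc N) = prodUpTo N *S ((oneS +S qPow (suc N)) *S invS (oneS -S qPow (suc N)))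

-- infinite product Π_{n≥1} (1+q^n)/(1-q^n) as a formal power series:
-- the coefficient of q^m is that of the finite product up to N = m
-- (factors with n > m do not affect the coefficient of q^m).
overpartProd : Series
overpartProd m = prodUpTo m m

binomX : ℕ → Poly
binomX k = prodP (applyUpTo (λ i → (+ 1 ℚ./ suc i) ·P (X +P constP (-q (+ i ℚ./ 1)))) k)

-- F^x for a series F with constant term 1 (x an indeterminate):
--   F^x = Σ_{k≥0} C(x,k) (F-1)^k   (the coefficient of q^n only needs k ≤ n)
powX : Series → Series
powX F n = sumP (List.map (λ k → binomX k *P ((F -S oneS) ^S k) n) (upTo (suc n)))

module Submission where

-- Work in ℚ[[x]][[q]] with the Euler operator θ = q d/dq, polynomials in x being read as their
-- coefficient sequences.  Each factor (1 + qⁿ)/(1 - qⁿ) of F = ∏ (1 + qⁿ)/(1 - qⁿ) has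
-- logarithmic derivative 2n ∑_{k odd} q^{nk}, and the coefficient of qⁱ in the sum of these is
-- twice the sum of the divisors d of i with i/d odd, that is σ̄(i); so θF = S F with S = ∑ σ̄(i) qⁱ.
-- The binomial series G = ∑ C(x,k) (F - 1)ᵏ satisfies F θG = x θF G by the recurrence
-- (k+1) C(x,k+1) = (x - k) C(x,k), hence θG = x S G.  The recurrence defining P̄ₙ says exactly
-- θP = x S P for P = ∑ P̄ₙ qⁿ.  Since θ multiplies the coefficient of qⁿ by n, a solution of
-- θZ = T Z with T₀ = 0 is determined by Z₀, so G = P.  Differentiating θP = x S P in x gives
-- θ(∂ₓP) = S P + x S ∂ₓP, which L P also satisfies for L = ∑ (σ̄(i)/i) qⁱ because θL = S; so
-- ∂ₓP = L P, and comparing coefficients gives the formula for P̄ₙ′.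

import Defs
import Data.Rational.Properties as ℚ
open import Algebra using (CommutativeSemiring; CommutativeRing)
open import Level using (_⊔_)

module FiniteSum {c ℓ} (R : CommutativeSemiring c ℓ) where

  open import Data.Nat using (ℕ; zero; suc; _∸_; _≤_; _<_)
    renaming (_+_ to _+ℕ_)
  import Data.Nat.Properties as ℕ
  open import Function using (_∘_)
  open import Relation.Binary.PropositionalEquality as ≡ using (_≡_)
  open import Relation.Nullary using (¬_; yes; no)

  open CommutativeSemiring R
  open import Relation.Binary.Reasoning.Setoid setoid
  open import Algebra.Properties.CommutativeSemigroup +-commutativeSemigroup
    using (interchange)

  ∑< : ℕ → (ℕ → Carrier) → Carrier
  ∑< zero    f = 0#
  ∑< (suc n) f = ∑< n f + f n

  syntax ∑< n (λ i → e) = ∑[ i < n ] e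

  ∑-cong< : ∀ n {f g} → (∀ i → i < n → f i ≈ g i) → ∑< n f ≈ ∑< n g
  ∑-cong< zero    eq = refl
  ∑-cong< (suc n) eq = +-cong (∑-cong< n (λ i i<n → eq i (ℕ.m<n⇒m<1+n i<n))) (eq n ℕ.≤-refl)

  ∑-cong : ∀ n {f g} → (∀ i → f i ≈ g i) → ∑< n f ≈ ∑< n g
  ∑-cong n eq = ∑-cong< n (λ i _ → eq i)

  ∑-≡ : ∀ {m n} f → m ≡ n → ∑< m f ≈ ∑< n f
  ∑-≡ f ≡.refl = refl

  ∑-zero : ∀ n {f} → (∀ i → i < n → f i ≈ 0#) → ∑< n f ≈ 0#
  ∑-zero n {f} eq = trans (∑-cong< n eq) (zeroSum n)
    where
    zeroSum : ∀ n → ∑< n (λ _ → 0#) ≈ 0#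
    zeroSum zero    = refl
    zeroSum (suc n) = trans (+-identityʳ _) (zeroSum n)

  ∑-distrib-+ : ∀ n f g → ∑[ i < n ] (f i + g i) ≈ ∑< n f + ∑< n g
  ∑-distrib-+ zero    f g = sym (+-identityˡ 0#)
  ∑-distrib-+ (suc n) f g = trans (+-congʳ (∑-distrib-+ n f g)) (interchange _ _ _ _)

  *-distribˡ-∑ : ∀ n a f → a * ∑< n f ≈ ∑[ i < n ] (a * f i)
  *-distribˡ-∑ zero    a f = zeroʳ a
  *-distribˡ-∑ (suc n) a f = trans (distribˡ a _ _) (+-congʳ (*-distribˡ-∑ n a f))

  *-distribʳ-∑ : ∀ n a f → ∑< n f * a ≈ ∑[ i < n ] (f i * a)
  *-distribʳ-∑ n a f =
    trans (*-comm _ a) (trans (*-distribˡ-∑ n a f) (∑-cong n (λ i → *-comm a (f i))))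

  ∑-shift : ∀ n f → ∑< (suc n) f ≈ f 0 + ∑[ i < n ] f (suc i)
  ∑-shift zero    f = trans (+-identityˡ _) (sym (+-identityʳ _))
  ∑-shift (suc n) f = trans (+-congʳ (∑-shift n f)) (+-assoc _ _ _)

  ∑-reverse : ∀ n f → ∑< n f ≈ ∑[ i < n ] f (n ∸ suc i)
  ∑-reverse zero    f = refl
  ∑-reverse (suc n) f = begin
    ∑< n f + f n                          ≈⟨ +-comm _ _ ⟩
    f n + ∑< n f                          ≈⟨ +-congˡ (∑-reverse n f) ⟩
    f n + ∑[ i < n ] f (n ∸ suc i)        ≈⟨ ∑-shift n (λ i → f (n ∸ i)) ⟨
    ∑[ i < suc n ] f (n ∸ i)              ∎

  ∑-evenOdd : ∀ m f → ∑< (m +ℕ m) f ≈ ∑[ j < m ] (f (j +ℕ j) + f (suc (j +ℕ j)))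
  ∑-evenOdd zero    f = refl
  ∑-evenOdd (suc m) f = begin
    ∑< (suc m +ℕ suc m) f                              ≈⟨ ∑-≡ f (≡.cong suc (ℕ.+-suc m m)) ⟩
    ∑< (m +ℕ m) f + f (m +ℕ m) + f (suc (m +ℕ m))      ≈⟨ +-assoc _ _ _ ⟩
    ∑< (m +ℕ m) f + (f (m +ℕ m) + f (suc (m +ℕ m)))    ≈⟨ +-congʳ (∑-evenOdd m f) ⟩
    ∑[ j < suc m ] (f (j +ℕ j) + f (suc (j +ℕ j)))     ∎

  ∑-single : ∀ n k {f} → k < n → (∀ i → i < n → ¬ i ≡ k → f i ≈ 0#) → ∑< n f ≈ f k
  ∑-single (suc n) k k<1+n eq with k ℕ.≟ n
  ... | yes ≡.refl = trans (+-congʳ (∑-zero n (λ i i<n → eq i (ℕ.m<n⇒m<1+n i<n) (ℕ.<⇒≢ i<n))))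
                           (+-identityˡ _)
  ... | no k≢n = trans (+-cong (∑-single n k (ℕ.≤∧≢⇒< (ℕ.≤-pred k<1+n) k≢n)
                                 (λ i i<n → eq i (ℕ.m<n⇒m<1+n i<n)))
                               (eq n ℕ.≤-refl (k≢n ∘ ≡.sym)))
                       (+-identityʳ _)

  ∑-extend : ∀ m n f → m ≤ n → (∀ j → m ≤ j → f j ≈ 0#) → ∑< n f ≈ ∑< m f
  ∑-extend m n f m≤n vanish = trans (∑-≡ f (≡.sym (ℕ.m∸n+n≡m m≤n))) (go (n ∸ m))
    where
    go : ∀ k → ∑< (k +ℕ m) f ≈ ∑< m f
    go zero    = refl
    go (suc k) = trans (+-cong (go k) (vanish (k +ℕ m) (ℕ.m≤n+m m k))) (+-identityʳ _)

  ∑-triangle : ∀ n (T : ℕ → ℕ → Carrier) →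
    ∑[ i < suc n ] ∑[ j < suc i ] T j i ≈ ∑[ j < suc n ] ∑[ k < suc (n ∸ j) ] T j (j +ℕ k)
  ∑-triangle zero    T = refl
  ∑-triangle (suc n) T = begin
    ∑[ i < suc n ] ∑[ j < suc i ] T j i + ∑[ j < suc (suc n) ] T j (suc n)
      ≈⟨ +-congʳ (∑-triangle n T) ⟩
    Rows + (∑[ j < suc n ] T j (suc n) + T (suc n) (suc n))
      ≈⟨ +-assoc _ _ _ ⟨
    (Rows + ∑[ j < suc n ] T j (suc n)) + T (suc n) (suc n)
      ≈⟨ +-cong (sym (trans (∑-cong< (suc n) longerRow) (∑-distrib-+ (suc n) _ _))) lastRow ⟩
    ∑[ j < suc (suc n) ] ∑[ k < suc (suc n ∸ j) ] T j (j +ℕ k) ∎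
    where
    Rows = ∑[ j < suc n ] ∑[ k < suc (n ∸ j) ] T j (j +ℕ k)
    longerRow : ∀ j → j < suc n →
      ∑[ k < suc (suc n ∸ j) ] T j (j +ℕ k) ≈ ∑[ k < suc (n ∸ j) ] T j (j +ℕ k) + T j (suc n)
    longerRow j j<1+n = trans (∑-≡ _ (≡.cong suc (ℕ.+-∸-assoc 1 (ℕ.≤-pred j<1+n))))
      (+-congˡ (reflexive (≡.cong (T j) (≡.trans (ℕ.+-suc j (n ∸ j))
                                                (≡.cong suc (ℕ.m+[n∸m]≡n (ℕ.≤-pred j<1+n)))))))
    lastRow : T (suc n) (suc n) ≈ ∑[ k < suc (suc n ∸ suc n) ] T (suc n) (suc n +ℕ k)
    lastRow = trans (reflexive (≡.cong (T (suc n)) (≡.sym (ℕ.+-identityʳ (suc n)))))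
      (trans (sym (+-identityˡ _)) (∑-≡ _ (≡.cong suc (≡.sym (ℕ.n∸n≡0 n)))))

module OddCofactorDivisors where

  open import Defs using (σ; σbar; split2)
  open import Data.Nat using (ℕ; zero; suc; _+_; _*_; _∸_; _^_; _≤_; _<_; _≤?_; _≟_; z≤n; s≤s)
  import Data.Nat.Properties as ℕ
  open import Data.Nat.Divisibility
  open import Data.Nat.DivMod using (_%_; _/_; m≡m%n+[m/n]*n; m%n<n; [m+kn]%n≡m%n; m/n<m)
  open import Data.Nat.ListAction using (sum)
  open import Data.List using (applyUpTo; filter)
  open import Data.Product using (proj₁; proj₂)
  open import Data.Empty using (⊥-elim)
  open import Function using (_∘_)
  open import Relation.Nullary using (Dec; yes; no; ¬_)
  open import Relation.Binary.PropositionalEquality as ≡ using (_≡_; refl; cong; sym; trans; subst)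
  open ≡.≡-Reasoning

  open FiniteSum ℕ.+-*-commutativeSemiring

  select : ∀ {p} {A : Set p} → Dec A → ℕ → ℕ
  select (yes _) n = n
  select (no _)  _ = 0

  -- The coefficient of q^i in 2d·q^d/(1 - q^{2d}) is twice this.
  oddMultipleWeight : ℕ → ℕ → ℕ
  oddMultipleWeight d i = select (d ≤? i) (select (2 * d ∣? (i ∸ d)) d)

  σOddCofactor : ℕ → ℕ
  σOddCofactor i = ∑[ j < i ] oddMultipleWeight (suc j) i

  divisorWeight : ℕ → ℕ → ℕ
  divisorWeight d i = select (d ∣? i) d

  oddMultipleWeight-< : ∀ d i → i < d → oddMultipleWeight d i ≡ 0
  oddMultipleWeight-< d i i<d with d ≤? i
  ... | yes d≤i = ⊥-elim (ℕ.<⇒≱ i<d d≤i)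
  ... | no _    = refl

  σOddCofactor-extend : ∀ n i → i ≤ n → ∑[ j < n ] oddMultipleWeight (suc j) i ≡ σOddCofactor i
  σOddCofactor-extend n i i≤n =
    ∑-extend i n _ i≤n (λ j i≤j → oddMultipleWeight-< (suc j) i (s≤s i≤j))

  σ≡∑divisorWeight : ∀ i → σ i ≡ ∑[ j < i ] divisorWeight (suc j) i
  σ≡∑divisorWeight i = go suc i
    where
    go : ∀ (g : ℕ → ℕ) n →
         sum (filter (_∣? i) (applyUpTo g n)) ≡ ∑[ j < n ] select (g j ∣? i) (g j)
    go g zero    = refl
    go g (suc n) = trans (head (g 0 ∣? i)) (sym (∑-shift n (λ j → select (g j ∣? i) (g j))))
      where
      head : Dec (g 0 ∣ i) →
             sum (filter (_∣? i) (applyUpTo g (suc n)))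
               ≡ select (g 0 ∣? i) (g 0) + ∑[ j < n ] select (g (suc j) ∣? i) (g (suc j))
      head _ with g 0 ∣? i
      ... | yes _ = cong (g 0 +_) (go (g ∘ suc) n)
      ... | no _  = go (g ∘ suc) n

  2∤1+2* : ∀ j → ¬ 2 ∣ suc (2 * j)
  2∤1+2* j 2∣ with () ← trans (sym (n∣m⇒m%n≡0 _ 2 2∣))
                              (trans (cong (λ m → suc m % 2) (ℕ.*-comm 2 j)) ([m+kn]%n≡m%n 1 j 2))

  odd⇒2∣pred : ∀ q → ¬ 2 ∣ q → 2 ∣ q ∸ 1
  odd⇒2∣pred q q-odd with q % 2 | m≡m%n+[m/n]*n q 2 | m%n<n q 2
  ... | zero        | eq | _ = ⊥-elim (q-odd (divides (q / 2) eq))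
  ... | suc zero    | eq | _ = divides (q / 2) (cong (_∸ 1) eq)
  ... | suc (suc r) | _  | s≤s (s≤s ())

  oddMultiple⇒∣ : ∀ d i → d ≤ i → 2 * d ∣ i ∸ d → d ∣ i
  oddMultiple⇒∣ d i d≤i 2d∣ = ∣m∸n∣n⇒∣m d d≤i (m*n∣⇒n∣ 2 d 2d∣) ∣-refl

  ∣⇒oddMultiple : ∀ d i → ¬ 2 ∣ i → d ∣ i → 2 * d ∣ i ∸ d
  ∣⇒oddMultiple d i i-odd (divides q refl) = subst (2 * d ∣_) qd-d (*-monoˡ-∣ d (odd⇒2∣pred q q-odd))
    where
    q-odd : ¬ 2 ∣ q
    q-odd 2∣q = i-odd (∣m⇒∣m*n d 2∣q)
    qd-d : (q ∸ 1) * d ≡ q * d ∸ d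
    qd-d = trans (ℕ.*-distribʳ-∸ d q 1) (cong (q * d ∸_) (ℕ.*-identityˡ d))

  σOddCofactor-odd : ∀ i → ¬ 2 ∣ i → σOddCofactor i ≡ σ i
  σOddCofactor-odd i i-odd = trans (∑-cong< i weight) (sym (σ≡∑divisorWeight i))
    where
    weight : ∀ j → j < i → oddMultipleWeight (suc j) i ≡ divisorWeight (suc j) i
    weight j j<i with suc j ≤? i
    ... | no j≮i = ⊥-elim (j≮i j<i)
    ... | yes d≤i with 2 * suc j ∣? (i ∸ suc j) | suc j ∣? i
    ... | yes _   | yes _  = refl
    ... | no _    | no _   = refl
    ... | yes 2d∣ | no d∤i = ⊥-elim (d∤i (oddMultiple⇒∣ (suc j) i d≤i 2d∣))
    ... | no 2d∤  | yes d∣i = ⊥-elim (2d∤ (∣⇒oddMultiple (suc j) i i-odd d∣i))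

  oddMultipleWeight-odd-even : ∀ j k → oddMultipleWeight (suc (2 * j)) (2 * k) ≡ 0
  oddMultipleWeight-odd-even j k with suc (2 * j) ≤? 2 * k
  ... | no _  = refl
  ... | yes d≤i with 2 * suc (2 * j) ∣? (2 * k ∸ suc (2 * j))
  ... | no _    = refl
  ... | yes 2d∣ = ⊥-elim (2∤1+2* j (∣m+n∣m⇒∣n 2∣i (m*n∣⇒m∣ 2 (suc (2 * j)) 2d∣)))
    where
    2∣i : 2 ∣ (2 * k ∸ suc (2 * j)) + suc (2 * j)
    2∣i = subst (2 ∣_) (sym (ℕ.m∸n+n≡m d≤i)) (m∣m*n k)

  oddMultipleWeight-double : ∀ d k → oddMultipleWeight (2 * d) (2 * k) ≡ 2 * oddMultipleWeight d k
  oddMultipleWeight-double d k with 2 * d ≤? 2 * k | d ≤? k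
  ... | no _     | no _    = refl
  ... | yes 2d≤  | no d≰k  = ⊥-elim (d≰k (ℕ.*-cancelˡ-≤ 2 2d≤))
  ... | no 2d≰   | yes d≤k = ⊥-elim (2d≰ (ℕ.*-monoʳ-≤ 2 d≤k))
  ... | yes _    | yes _ with 2 * (2 * d) ∣? (2 * k ∸ 2 * d) | 2 * d ∣? (k ∸ d)
  ... | yes _ | yes _ = refl
  ... | no _  | no _  = refl
  ... | yes p | no q  = ⊥-elim (q (*-cancelˡ-∣ 2 (subst (2 * (2 * d) ∣_) (sym (ℕ.*-distribˡ-∸ 2 k d)) p)))
  ... | no p  | yes q = ⊥-elim (p (subst (2 * (2 * d) ∣_) (ℕ.*-distribˡ-∸ 2 k d) (*-monoʳ-∣ 2 q)))

  σOddCofactor-double : ∀ k → σOddCofactor (2 * k) ≡ 2 * σOddCofactor k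
  σOddCofactor-double k = begin
    ∑[ j < 2 * k ] oddMultipleWeight (suc j) (2 * k)
      ≡⟨ ∑-≡ _ (cong (k +_) (ℕ.+-identityʳ k)) ⟩
    ∑[ j < k + k ] oddMultipleWeight (suc j) (2 * k)
      ≡⟨ ∑-evenOdd k _ ⟩
    ∑[ j < k ] (oddMultipleWeight (suc (j + j)) (2 * k) + oddMultipleWeight (suc (suc (j + j))) (2 * k))
      ≡⟨ ∑-cong k pair ⟩
    ∑[ j < k ] (2 * oddMultipleWeight (suc j) k)
      ≡⟨ *-distribˡ-∑ k 2 _ ⟨
    2 * σOddCofactor k ∎
    where
    j+j≡2j : ∀ j → j + j ≡ 2 * j
    j+j≡2j j = cong (j +_) (sym (ℕ.+-identityʳ j))
    pair : ∀ j → oddMultipleWeight (suc (j + j)) (2 * k) + oddMultipleWeight (suc (suc (j + j))) (2 * k)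
                   ≡ 2 * oddMultipleWeight (suc j) k
    pair j = ≡.cong₂ _+_
      (trans (cong (λ m → oddMultipleWeight (suc m) (2 * k)) (j+j≡2j j)) (oddMultipleWeight-odd-even j k))
      (trans (cong (λ m → oddMultipleWeight m (2 * k)) (trans (sym (ℕ.+-suc (suc j) j)) (j+j≡2j (suc j))))
             (oddMultipleWeight-double (suc j) k))

  σOddCofactor≡split2 : ∀ f i → i ≤ f →
    σOddCofactor i ≡ 2 ^ proj₁ (split2 f i) * σ (proj₂ (split2 f i))
  σOddCofactor≡split2 zero    zero    _         = refl
  σOddCofactor≡split2 (suc f) zero    _         = refl
  σOddCofactor≡split2 (suc f) (suc x) (s≤s x≤f) with suc x % 2 ≟ 0 | m≡m%n+[m/n]*n (suc x) 2
  ... | no odd  | _  = trans (σOddCofactor-odd (suc x) (odd ∘ n∣m⇒m%n≡0 (suc x) 2))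
                             (sym (ℕ.+-identityʳ _))
  ... | yes even | eq = begin
    σOddCofactor (suc x)                      ≡⟨ cong σOddCofactor x+1≡2k ⟩
    σOddCofactor (2 * k)                      ≡⟨ σOddCofactor-double k ⟩
    2 * σOddCofactor k                        ≡⟨ cong (2 *_) (σOddCofactor≡split2 f k k≤f) ⟩
    2 * (2 ^ proj₁ r * σ (proj₂ r))           ≡⟨ ℕ.*-assoc 2 (2 ^ proj₁ r) _ ⟨
    2 ^ suc (proj₁ r) * σ (proj₂ r)           ∎
    where
    k = suc x / 2
    r = split2 f k
    x+1≡2k : suc x ≡ 2 * k
    x+1≡2k = trans eq (trans (cong (_+ k * 2) even) (ℕ.*-comm k 2))
    k≤f : k ≤ f
    k≤f = ℕ.≤-trans (ℕ.≤-pred (m/n<m (suc x) 2 (s≤s (s≤s z≤n)))) x≤f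

  σbar≡2*σOddCofactor : ∀ i → σbar i ≡ 2 * σOddCofactor i
  σbar≡2*σOddCofactor i = begin
    σbar i                                    ≡⟨ ℕ.*-assoc 2 (2 ^ proj₁ (split2 i i)) _ ⟩
    2 * (2 ^ proj₁ (split2 i i) * σ (proj₂ (split2 i i)))
                                              ≡⟨ cong (2 *_) (σOddCofactor≡split2 i i ℕ.≤-refl) ⟨
    2 * σOddCofactor i                        ∎

record IsDerivation {c ℓ} (R : CommutativeRing c ℓ)
                    (d : CommutativeRing.Carrier R → CommutativeRing.Carrier R) : Set (c ⊔ ℓ) where
  open CommutativeRing R
  field
    cong    : ∀ {a b} → a ≈ b → d a ≈ d b
    +-homo  : ∀ a b → d (a + b) ≈ d a + d b
    leibniz : ∀ a b → d (a * b) ≈ d a * b + a * d b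

module PowerSeries {c ℓ} (R : CommutativeRing c ℓ) where

  open import Data.Nat as ℕ using (ℕ; zero; suc; _∸_; _≤_; _<_; _≤?_; _<?_; _≟_; z≤n; s≤s)
    renaming (_+_ to _+ℕ_)
  import Data.Nat.Properties as ℕ
  open import Data.Nat.Divisibility using (_∣_; _∣?_; ∣m+n∣m⇒∣n; ∣m∸n∣n⇒∣m; ∣-refl; _∣0; ∣⇒≤)
  open import Data.Product using (_,_)
  open import Data.Empty using (⊥-elim)
  open import Relation.Binary using (IsEquivalence)
  open import Algebra.Structures using (IsCommutativeRing)
  open import Relation.Nullary using (Dec; yes; no; ¬_)
  open import Relation.Binary.PropositionalEquality as ≡ using (_≡_)
  import Algebra.Properties.Ring
  import Algebra.Properties.Semiring.Mult

  open CommutativeRing R hiding (zero)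
  open import Relation.Binary.Reasoning.Setoid setoid
  open import Algebra.Properties.Ring ring using (-‿distribʳ-*; -0#≈0#; -‿+-comm; +-identityˡ-unique)
  open import Algebra.Properties.Semiring.Mult semiring
    using (_×_; ×-congʳ; ×-homo-+; ×-assoc-*; ×-comm-*)
  open import Algebra.Properties.CommutativeMonoid.Mult +-commutativeMonoid using (×-distrib-+)
  open import Algebra.Properties.CommutativeSemigroup +-commutativeSemigroup using (interchange)
  open FiniteSum commutativeSemiring public

  Series : Set c
  Series = ℕ → Carrier

  infix 4 _≋_
  _≋_ : Series → Series → Set ℓ
  f ≋ g = ∀ n → f n ≈ g n

  infixl 6 _⊕_
  infixl 7 _⊛_
  infix 8 ⊝_

  -- The ring operations are opaque and their coefficients are read off through ⊕-coeff, ⊝-coeff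
  -- and ⊛-coeff: unfolding them would expose the coefficient ring's arithmetic (for ℚ, the
  -- normalisation of fractions) to unification.
  opaque
    _⊕_ : Series → Series → Series
    (f ⊕ g) n = f n + g n

    ⊝_ : Series → Series
    (⊝ f) n = - f n

    ⊕-coeff : ∀ f g n → (f ⊕ g) n ≈ f n + g n
    ⊕-coeff f g n = refl

    ⊝-coeff : ∀ f n → (⊝ f) n ≈ - f n
    ⊝-coeff f n = refl

  κ : Carrier → Series
  κ a zero    = a
  κ a (suc _) = 0#

  𝟘 𝟙 : Series
  𝟘 _ = 0#
  𝟙 = κ 1#

  opaque
    _⊛_ : Series → Series → Series
    (f ⊛ g) n = ∑[ i < suc n ] (f i * g (n ∸ i))

    ⊛-coeff : ∀ f g n → (f ⊛ g) n ≈ ∑[ i < suc n ] (f i * g (n ∸ i))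
    ⊛-coeff f g n = refl

  indicator : ∀ {p} {A : Set p} → Dec A → Carrier
  indicator (yes _) = 1#
  indicator (no _)  = 0#

  q^_ : ℕ → Series
  (q^ k) i = indicator (i ≟ k)

  geom : ℕ → Series
  geom m i = indicator (m ∣? i)

  θ : Series → Series
  θ f n = n × f n

  ∂ : Series → Series
  ∂ f n = suc n × f (suc n)

  NatTorsionFree : Set (c ⊔ ℓ)
  NatTorsionFree = ∀ m {a} → suc m × a ≈ 0# → a ≈ 0#

  opaque
    unfolding _⊕_ ⊝_

    ⊛-cong : ∀ {f f′ g g′} → f ≋ f′ → g ≋ g′ → f ⊛ g ≋ f′ ⊛ g′
    ⊛-cong {f} {f′} {g} {g′} f≋f′ g≋g′ n = begin
      (f ⊛ g) n                               ≈⟨ ⊛-coeff f g n ⟩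
      ∑[ i < suc n ] (f i * g (n ∸ i))        ≈⟨ ∑-cong (suc n) (λ i → *-cong (f≋f′ i) (g≋g′ (n ∸ i))) ⟩
      ∑[ i < suc n ] (f′ i * g′ (n ∸ i))      ≈⟨ ⊛-coeff f′ g′ n ⟨
      (f′ ⊛ g′) n                             ∎

    ⊛-comm : ∀ f g → f ⊛ g ≋ g ⊛ f
    ⊛-comm f g n = begin
      (f ⊛ g) n                                           ≈⟨ ⊛-coeff f g n ⟩
      ∑[ i < suc n ] (f i * g (n ∸ i))                    ≈⟨ ∑-reverse (suc n) _ ⟩
      ∑[ i < suc n ] (f (n ∸ i) * g (n ∸ (n ∸ i)))        ≈⟨ ∑-cong< (suc n) swap ⟩
      ∑[ i < suc n ] (g i * f (n ∸ i))                    ≈⟨ ⊛-coeff g f n ⟨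
      (g ⊛ f) n                                           ∎
      where
      swap : ∀ i → i < suc n → f (n ∸ i) * g (n ∸ (n ∸ i)) ≈ g i * f (n ∸ i)
      swap i i<1+n = trans (*-comm _ _) (*-congʳ (reflexive (≡.cong g (ℕ.m∸[m∸n]≡n (ℕ.≤-pred i<1+n)))))

    ⊛-assoc : ∀ f g h → (f ⊛ g) ⊛ h ≋ f ⊛ (g ⊛ h)
    ⊛-assoc f g h n = begin
      ((f ⊛ g) ⊛ h) n
        ≈⟨ ⊛-coeff (f ⊛ g) h n ⟩
      ∑[ i < suc n ] ((f ⊛ g) i * h (n ∸ i))
        ≈⟨ ∑-cong (suc n) (λ i → trans (*-congʳ (⊛-coeff f g i)) (*-distribʳ-∑ (suc i) _ _)) ⟩
      ∑[ i < suc n ] ∑[ j < suc i ] (f j * g (i ∸ j) * h (n ∸ i))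
        ≈⟨ ∑-triangle n (λ j i → f j * g (i ∸ j) * h (n ∸ i)) ⟩
      ∑[ j < suc n ] ∑[ k < suc (n ∸ j) ] (f j * g (j +ℕ k ∸ j) * h (n ∸ (j +ℕ k)))
        ≈⟨ ∑-cong (suc n) (λ j → trans (∑-cong (suc (n ∸ j)) (reindex j)) (sym (*-distribˡ-∑ (suc (n ∸ j)) (f j) _))) ⟩
      ∑[ j < suc n ] (f j * ∑[ k < suc (n ∸ j) ] (g k * h (n ∸ j ∸ k)))
        ≈⟨ ∑-cong (suc n) (λ j → *-congˡ (⊛-coeff g h (n ∸ j))) ⟨
      ∑[ j < suc n ] (f j * (g ⊛ h) (n ∸ j))
        ≈⟨ ⊛-coeff f (g ⊛ h) n ⟨
      (f ⊛ (g ⊛ h)) n ∎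
      where
      reindex : ∀ j k → f j * g (j +ℕ k ∸ j) * h (n ∸ (j +ℕ k)) ≈ f j * (g k * h (n ∸ j ∸ k))
      reindex j k = trans (*-assoc _ _ _) (*-congˡ (*-cong (reflexive (≡.cong g (ℕ.m+n∸m≡n j k)))
                                                           (reflexive (≡.cong h (≡.sym (ℕ.∸-+-assoc n j k))))))

    κ⊛ : ∀ a f → κ a ⊛ f ≋ λ n → a * f n
    κ⊛ a f n = begin
      (κ a ⊛ f) n                                   ≈⟨ ⊛-coeff (κ a) f n ⟩
      ∑[ i < suc n ] (κ a i * f (n ∸ i))            ≈⟨ ∑-shift n _ ⟩
      a * f n + ∑[ i < n ] (0# * f (n ∸ suc i))     ≈⟨ +-congˡ (∑-zero n (λ i _ → zeroˡ _)) ⟩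
      a * f n + 0#                                  ≈⟨ +-identityʳ _ ⟩
      a * f n                                       ∎

    ⊛-identityˡ : ∀ f → 𝟙 ⊛ f ≋ f
    ⊛-identityˡ f n = trans (κ⊛ 1# f n) (*-identityˡ (f n))

    ⊛-distribˡ : ∀ f g h → f ⊛ (g ⊕ h) ≋ f ⊛ g ⊕ f ⊛ h
    ⊛-distribˡ f g h n = begin
      (f ⊛ (g ⊕ h)) n                                              ≈⟨ ⊛-coeff f (g ⊕ h) n ⟩
      ∑[ i < suc n ] (f i * (g (n ∸ i) + h (n ∸ i)))               ≈⟨ ∑-cong (suc n) (λ i → distribˡ (f i) _ _) ⟩
      ∑[ i < suc n ] (f i * g (n ∸ i) + f i * h (n ∸ i))           ≈⟨ ∑-distrib-+ (suc n) _ _ ⟩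
      ∑[ i < suc n ] (f i * g (n ∸ i)) + ∑[ i < suc n ] (f i * h (n ∸ i))
                                                                   ≈⟨ +-cong (⊛-coeff f g n) (⊛-coeff f h n) ⟨
      (f ⊛ g ⊕ f ⊛ h) n                                            ∎

    ⊕-⊛-isCommutativeRing : IsCommutativeRing _≋_ _⊕_ _⊛_ ⊝_ 𝟘 𝟙
    ⊕-⊛-isCommutativeRing = record
      { isRing = record
        { +-isAbelianGroup = record
          { isGroup = record
            { isMonoid = record
              { isSemigroup = record
                { isMagma = record { isEquivalence = ≋-isEquivalence ; ∙-cong = λ p q n → +-cong (p n) (q n) }
                ; assoc = λ f g h n → +-assoc (f n) (g n) (h n) }
              ; identity = (λ f n → +-identityˡ (f n)) , (λ f n → +-identityʳ (f n)) }
            ; inverse = (λ f n → -‿inverseˡ (f n)) , (λ f n → -‿inverseʳ (f n))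
            ; ⁻¹-cong = λ p n → -‿cong (p n) }
          ; comm = λ f g n → +-comm (f n) (g n) }
        ; *-cong = ⊛-cong
        ; *-assoc = ⊛-assoc
        ; *-identity = ⊛-identityˡ , (λ f n → trans (⊛-comm f 𝟙 n) (⊛-identityˡ f n))
        ; distrib = ⊛-distribˡ , (λ f g h n → trans (⊛-comm (g ⊕ h) f n)
                                  (trans (⊛-distribˡ f g h n) (+-cong (⊛-comm f g n) (⊛-comm f h n)))) }
      ; *-comm = ⊛-comm }
      where
      ≋-isEquivalence : IsEquivalence _≋_
      ≋-isEquivalence = record
        { refl = λ _ → refl ; sym = λ p n → sym (p n) ; trans = λ p q n → trans (p n) (q n) }

    κ-+ : ∀ a b → κ (a + b) ≋ κ a ⊕ κ b
    κ-+ a b zero    = refl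
    κ-+ a b (suc n) = sym (+-identityˡ 0#)

    κ-* : ∀ a b → κ (a * b) ≋ κ a ⊛ κ b
    κ-* a b n = sym (trans (κ⊛ a (κ b) n) (scaled n))
      where
      scaled : ∀ n → a * κ b n ≈ κ (a * b) n
      scaled zero    = refl
      scaled (suc n) = zeroʳ a

    κ-cong : ∀ {a b} → a ≈ b → κ a ≋ κ b
    κ-cong a≈b zero    = a≈b
    κ-cong a≈b (suc n) = refl

    κ-neg : ∀ a → κ (- a) ≋ ⊝ κ a
    κ-neg a zero    = refl
    κ-neg a (suc n) = sym -0#≈0#

    κ-0 : κ 0# ≋ 𝟘
    κ-0 zero    = refl
    κ-0 (suc n) = refl

  seriesRing : CommutativeRing c ℓ
  seriesRing = record
    { Carrier = Series ; _≈_ = _≋_ ; _+_ = _⊕_ ; _*_ = _⊛_ ; -_ = ⊝_ ; 0# = 𝟘 ; 1# = 𝟙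
    ; isCommutativeRing = ⊕-⊛-isCommutativeRing }

  private module SeriesRing = Algebra.Properties.Ring (CommutativeRing.ring seriesRing)
  private module SeriesMult = Algebra.Properties.Semiring.Mult (CommutativeRing.semiring seriesRing)

  opaque
    unfolding _⊕_ ⊝_

    ×-coeff : ∀ m f n → (m SeriesMult.× f) n ≈ m × f n
    ×-coeff zero    f n = refl
    ×-coeff (suc m) f n = +-congˡ (×-coeff m f n)

    ×-κ : ∀ m a → m SeriesMult.× κ a ≋ κ (m × a)
    ×-κ zero    a n       = sym (κ-0 n)
    ×-κ (suc m) a zero    = +-congˡ (×-κ m a zero)
    ×-κ (suc m) a (suc n) = trans (+-congˡ (×-κ m a (suc n))) (+-identityˡ 0#)

    ⊛-cong≤ : ∀ m {f f′ g g′} → (∀ i → i ≤ m → f i ≈ f′ i) → (∀ i → i ≤ m → g i ≈ g′ i) →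
              ∀ n → n ≤ m → (f ⊛ g) n ≈ (f′ ⊛ g′) n
    ⊛-cong≤ m {f} {f′} {g} {g′} f≈f′ g≈g′ n n≤m = begin
      (f ⊛ g) n                             ≈⟨ ⊛-coeff f g n ⟩
      ∑[ i < suc n ] (f i * g (n ∸ i))      ≈⟨ ∑-cong< (suc n) (λ i i<1+n → *-cong (f≈f′ i (i≤m i<1+n))
                                                                               (g≈g′ (n ∸ i) (ℕ.≤-trans (ℕ.m∸n≤m n i) n≤m))) ⟩
      ∑[ i < suc n ] (f′ i * g′ (n ∸ i))    ≈⟨ ⊛-coeff f′ g′ n ⟨
      (f′ ⊛ g′) n                           ∎
      where
      i≤m : ∀ {i} → i < suc n → i ≤ m
      i≤m i<1+n = ℕ.≤-trans (ℕ.≤-pred i<1+n) n≤m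

    ⊛-vanishes : ∀ k l f g → (∀ i → i < k → f i ≈ 0#) → (∀ i → i < l → g i ≈ 0#) →
                 ∀ n → n < k +ℕ l → (f ⊛ g) n ≈ 0#
    ⊛-vanishes k l f g f≈0 g≈0 n n<k+l = trans (⊛-coeff f g n) (∑-zero (suc n) term)
      where
      term : ∀ i → i < suc n → f i * g (n ∸ i) ≈ 0#
      term i i<1+n with i <? k
      ... | yes i<k = trans (*-congʳ (f≈0 i i<k)) (zeroˡ _)
      ... | no i≮k  = trans (*-congˡ (g≈0 (n ∸ i) n∸i<l)) (zeroʳ _)
        where
        i≤n : i ≤ n
        i≤n = ℕ.≤-pred i<1+n
        n∸i<l : n ∸ i < l
        n∸i<l = ℕ.+-cancelˡ-< i (n ∸ i) l
          (≡.subst (_< i +ℕ l) (≡.sym (ℕ.m+[n∸m]≡n i≤n)) (ℕ.<-≤-trans n<k+l (ℕ.+-monoˡ-≤ l (ℕ.≮⇒≥ i≮k))))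

    q^-coeff-≡ : ∀ k i → i ≡ k → (q^ k) i ≈ 1#
    q^-coeff-≡ k i i≡k with i ≟ k
    ... | yes _   = refl
    ... | no i≢k  = ⊥-elim (i≢k i≡k)

    q^-coeff-≢ : ∀ k i → ¬ i ≡ k → (q^ k) i ≈ 0#
    q^-coeff-≢ k i i≢k with i ≟ k
    ... | yes i≡k = ⊥-elim (i≢k i≡k)
    ... | no _    = refl

    ⊛q^-coeff-≥ : ∀ f k n → k ≤ n → (f ⊛ q^ k) n ≈ f (n ∸ k)
    ⊛q^-coeff-≥ f k n k≤n = begin
      (f ⊛ q^ k) n                         ≈⟨ ⊛-coeff f (q^ k) n ⟩
      ∑[ i < suc n ] (f i * (q^ k) (n ∸ i)) ≈⟨ ∑-single (suc n) (n ∸ k) (s≤s (ℕ.m∸n≤m n k)) off ⟩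
      f (n ∸ k) * (q^ k) (n ∸ (n ∸ k))     ≈⟨ *-congˡ (q^-coeff-≡ k _ (ℕ.m∸[m∸n]≡n k≤n)) ⟩
      f (n ∸ k) * 1#                       ≈⟨ *-identityʳ _ ⟩
      f (n ∸ k)                            ∎
      where
      off : ∀ i → i < suc n → ¬ i ≡ n ∸ k → f i * (q^ k) (n ∸ i) ≈ 0#
      off i i<1+n i≢ = trans (*-congˡ (q^-coeff-≢ k (n ∸ i) λ n∸i≡k →
          i≢ (≡.trans (≡.sym (ℕ.m∸[m∸n]≡n (ℕ.≤-pred i<1+n))) (≡.cong (n ∸_) n∸i≡k)))) (zeroʳ _)

    ⊛q^-coeff-< : ∀ f k n → n < k → (f ⊛ q^ k) n ≈ 0#
    ⊛q^-coeff-< f k n n<k = trans (⊛-coeff f (q^ k) n) (∑-zero (suc n) λ i _ →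
      trans (*-congˡ (q^-coeff-≢ k (n ∸ i) λ n∸i≡k → ℕ.<⇒≢ (ℕ.≤-<-trans (ℕ.m∸n≤m n i) n<k) n∸i≡k)) (zeroʳ _))

    q^-+ : ∀ a b → q^ a ⊛ q^ b ≋ q^ (a +ℕ b)
    q^-+ a b n with b ≤? n
    ... | no b≰n = trans (⊛q^-coeff-< (q^ a) b n (ℕ.≰⇒> b≰n))
                     (sym (q^-coeff-≢ (a +ℕ b) n λ n≡a+b → b≰n (≡.subst (b ≤_) (≡.sym n≡a+b) (ℕ.m≤n+m b a))))
    ... | yes b≤n with n ∸ b ≟ a
    ... | yes n∸b≡a = trans (⊛q^-coeff-≥ (q^ a) b n b≤n) (trans (q^-coeff-≡ a _ n∸b≡a)
                        (sym (q^-coeff-≡ (a +ℕ b) n (≡.trans (≡.sym (ℕ.m∸n+n≡m b≤n)) (≡.cong (_+ℕ b) n∸b≡a)))))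
    ... | no n∸b≢a  = trans (⊛q^-coeff-≥ (q^ a) b n b≤n) (trans (q^-coeff-≢ a _ n∸b≢a)
                        (sym (q^-coeff-≢ (a +ℕ b) n λ n≡a+b → n∸b≢a (≡.trans (≡.cong (_∸ b) n≡a+b) (ℕ.m+n∸n≡m a b)))))

    geom-coeff-< : ∀ m i → i < suc m → geom (suc m) i ≈ 𝟙 i
    geom-coeff-< m zero    _ with suc m ∣? 0
    ... | yes _ = refl
    ... | no ∤0 = ⊥-elim (∤0 (suc m ∣0))
    geom-coeff-< m (suc i) i<1+m with suc m ∣? suc i
    ... | yes ∣i = ⊥-elim (ℕ.<⇒≱ i<1+m (∣⇒≤ ∣i))
    ... | no _   = refl

    geom-inverse : ∀ m → geom (suc m) ⊛ (𝟙 ⊕ ⊝ q^ suc m) ≋ 𝟙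
    geom-inverse m n = begin
      (e ⊛ (𝟙 ⊕ ⊝ q^ suc m)) n        ≈⟨ ⊛-distribˡ e 𝟙 (⊝ q^ suc m) n ⟩
      (e ⊛ 𝟙) n + (e ⊛ ⊝ q^ suc m) n  ≈⟨ +-cong (trans (⊛-comm e 𝟙 n) (⊛-identityˡ e n)) negate ⟩
      e n + - (e ⊛ q^ suc m) n        ≈⟨ shifted (suc m ≤? n) ⟩
      𝟙 n                             ∎
      where
      e : Series
      e = geom (suc m)
      negate : (e ⊛ ⊝ q^ suc m) n ≈ - (e ⊛ q^ suc m) n
      negate = sym (SeriesRing.-‿distribʳ-* e (q^ suc m) n)
      shifted : Dec (suc m ≤ n) → e n + - (e ⊛ q^ suc m) n ≈ 𝟙 n
      shifted (no m≮n) = trans (+-congˡ (trans (-‿cong (⊛q^-coeff-< e (suc m) n (ℕ.≰⇒> m≮n))) -0#≈0#))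
                               (trans (+-identityʳ _) (geom-coeff-< m n (ℕ.≰⇒> m≮n)))
      shifted (yes m<n) = trans (+-congˡ (-‿cong (⊛q^-coeff-≥ e (suc m) n m<n)))
                          (trans (same (suc m ∣? n) (suc m ∣? (n ∸ suc m))) (sym (𝟙-coeff-pos (ℕ.<-≤-trans (s≤s z≤n) m<n))))
        where
        𝟙-coeff-pos : ∀ {n} → 0 < n → 𝟙 n ≈ 0#
        𝟙-coeff-pos {suc _} _ = refl
        same : (p : Dec (suc m ∣ n)) (p′ : Dec (suc m ∣ n ∸ suc m)) → indicator p + - indicator p′ ≈ 0#
        same (yes _) (yes _) = -‿inverseʳ 1#
        same (no _)  (no _)  = -‿inverseʳ 0#
        same (yes d∣n) (no d∤) = ⊥-elim (d∤ (∣m+n∣m⇒∣n (≡.subst (suc m ∣_) (≡.sym (ℕ.m+[n∸m]≡n m<n)) d∣n) ∣-refl))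
        same (no d∤n) (yes d∣) = ⊥-elim (d∤n (∣m∸n∣n⇒∣m (suc m) m<n d∣ ∣-refl))

    ×-zeroʳ : ∀ n → n × 0# ≈ 0#
    ×-zeroʳ n = trans (×-congʳ n (sym (zeroˡ 0#))) (trans (sym (×-comm-* n 0# 0#)) (zeroˡ _))

    θ-cong : ∀ {f g} → f ≋ g → θ f ≋ θ g
    θ-cong f≋g n = ×-congʳ n (f≋g n)

    θ-⊕ : ∀ f g → θ (f ⊕ g) ≋ θ f ⊕ θ g
    θ-⊕ f g n = ×-distrib-+ (f n) (g n) n

    θ-κ : ∀ a → θ (κ a) ≋ 𝟘
    θ-κ a zero    = refl
    θ-κ a (suc n) = ×-zeroʳ (suc n)

    θ-neg : ∀ f → θ (⊝ f) ≋ ⊝ θ f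
    θ-neg f n = begin
      n × - f n                ≈⟨ ×-congʳ n (*-identityˡ (- f n)) ⟨
      n × (1# * - f n)         ≈⟨ ×-assoc-* n 1# (- f n) ⟨
      (n × 1#) * - f n         ≈⟨ -‿distribʳ-* _ _ ⟨
      - ((n × 1#) * f n)       ≈⟨ -‿cong (trans (×-assoc-* n 1# (f n)) (×-congʳ n (*-identityˡ _))) ⟩
      - (n × f n)              ∎

    θ-⊛ : ∀ f g → θ (f ⊛ g) ≋ θ f ⊛ g ⊕ f ⊛ θ g
    θ-⊛ f g n = begin
      n × (f ⊛ g) n
        ≈⟨ ×-congʳ n (⊛-coeff f g n) ⟩
      n × ∑[ i < suc n ] (f i * g (n ∸ i))
        ≈⟨ ×-distrib-∑ n (suc n) _ ⟩
      ∑[ i < suc n ] (n × (f i * g (n ∸ i)))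
        ≈⟨ ∑-cong< (suc n) split ⟩
      ∑[ i < suc n ] ((i × f i) * g (n ∸ i) + f i * ((n ∸ i) × g (n ∸ i)))
        ≈⟨ ∑-distrib-+ (suc n) _ _ ⟩
      ∑[ i < suc n ] ((i × f i) * g (n ∸ i)) + ∑[ i < suc n ] (f i * ((n ∸ i) × g (n ∸ i)))
        ≈⟨ +-cong (⊛-coeff (θ f) g n) (⊛-coeff f (θ g) n) ⟨
      (θ f ⊛ g ⊕ f ⊛ θ g) n ∎
      where
      ×-distrib-∑ : ∀ m k h → m × ∑< k h ≈ ∑[ i < k ] (m × h i)
      ×-distrib-∑ m zero    h = ×-zeroʳ m
      ×-distrib-∑ m (suc k) h = trans (×-distrib-+ _ _ m) (+-congʳ (×-distrib-∑ m k h))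
      split : ∀ i → i < suc n → n × (f i * g (n ∸ i)) ≈ (i × f i) * g (n ∸ i) + f i * ((n ∸ i) × g (n ∸ i))
      split i i<1+n = begin
        n × (f i * g (n ∸ i))
          ≈⟨ reflexive (≡.cong (_× (f i * g (n ∸ i))) (≡.sym (ℕ.m+[n∸m]≡n (ℕ.≤-pred i<1+n)))) ⟩
        (i +ℕ (n ∸ i)) × (f i * g (n ∸ i))
          ≈⟨ ×-homo-+ _ i (n ∸ i) ⟩
        i × (f i * g (n ∸ i)) + (n ∸ i) × (f i * g (n ∸ i))
          ≈⟨ +-cong (sym (×-assoc-* i _ _)) (sym (×-comm-* (n ∸ i) _ _)) ⟩
        (i × f i) * g (n ∸ i) + f i * ((n ∸ i) × g (n ∸ i)) ∎

    θ-q^ : ∀ k → θ (q^ k) ≋ k SeriesMult.× q^ k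
    θ-q^ k n = trans (same-exponent (n ≟ k)) (sym (×-coeff k (q^ k) n))
      where
      same-exponent : Dec (n ≡ k) → n × (q^ k) n ≈ k × (q^ k) n
      same-exponent (yes ≡.refl) = refl
      same-exponent (no n≢k)     = trans (×-congʳ n (q^-coeff-≢ k n n≢k))
                                    (trans (×-zeroʳ n) (sym (trans (×-congʳ k (q^-coeff-≢ k n n≢k)) (×-zeroʳ k))))

    ∂-κ : ∀ a → ∂ (κ a) ≋ 𝟘
    ∂-κ a n = ×-zeroʳ (suc n)

    ∂-q : ∂ (q^ 1) ≋ 𝟙
    ∂-q zero    = trans (+-identityʳ _) (q^-coeff-≡ 1 1 ≡.refl)
    ∂-q (suc n) = ×-zeroʳ (suc (suc n))

    ∂-isDerivation : IsDerivation seriesRing ∂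
    ∂-isDerivation = record
      { cong    = λ f≋g n → ×-congʳ (suc n) (f≋g (suc n))
      ; +-homo  = λ f g n → ×-distrib-+ (f (suc n)) (g (suc n)) (suc n)
      ; leibniz = ∂-⊛ }
      where
      ∂-⊛ : ∀ f g → ∂ (f ⊛ g) ≋ ∂ f ⊛ g ⊕ f ⊛ ∂ g
      ∂-⊛ f g n = begin
        θ (f ⊛ g) (suc n)                         ≈⟨ θ-⊛ f g (suc n) ⟩
        (θ f ⊛ g) (suc n) + (f ⊛ θ g) (suc n)     ≈⟨ +-cong left right ⟩
        (∂ f ⊛ g) n + (f ⊛ ∂ g) n                 ∎
        where
        left : (θ f ⊛ g) (suc n) ≈ (∂ f ⊛ g) n
        left = begin
          (θ f ⊛ g) (suc n)                               ≈⟨ ⊛-coeff (θ f) g (suc n) ⟩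
          ∑[ i < suc (suc n) ] (θ f i * g (suc n ∸ i))    ≈⟨ ∑-shift (suc n) _ ⟩
          0# * g (suc n) + ∑[ i < suc n ] (∂ f i * g (n ∸ i))
                                                          ≈⟨ trans (+-congʳ (zeroˡ _)) (+-identityˡ _) ⟩
          ∑[ i < suc n ] (∂ f i * g (n ∸ i))              ≈⟨ ⊛-coeff (∂ f) g n ⟨
          (∂ f ⊛ g) n                                     ∎
        right : (f ⊛ θ g) (suc n) ≈ (f ⊛ ∂ g) n
        right = begin
          (f ⊛ θ g) (suc n)                                       ≈⟨ ⊛-coeff f (θ g) (suc n) ⟩
          ∑[ i < suc n ] (f i * θ g (suc n ∸ i)) + f (suc n) * θ g (suc n ∸ suc n)
            ≈⟨ +-cong (∑-cong< (suc n) λ i i<1+n →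
                         *-congˡ (reflexive (≡.cong (θ g) (ℕ.+-∸-assoc 1 (ℕ.≤-pred i<1+n)))))
                      (*-congˡ (reflexive (≡.cong (θ g) (ℕ.n∸n≡0 n)))) ⟩
          ∑[ i < suc n ] (f i * ∂ g (n ∸ i)) + f (suc n) * 0#     ≈⟨ trans (+-congˡ (zeroʳ _)) (+-identityʳ _) ⟩
          ∑[ i < suc n ] (f i * ∂ g (n ∸ i))                      ≈⟨ ⊛-coeff f (∂ g) n ⟨
          (f ⊛ ∂ g) n                                             ∎

    -- Comparing coefficients of q^n in θ Z = T Z gives n Z n = ∑_{1 ≤ i ≤ n} T i Z (n - i).
    θ-solution-zero : NatTorsionFree → ∀ T Z → T 0 ≈ 0# → Z 0 ≈ 0# → θ Z ≋ T ⊛ Z → Z ≋ 𝟘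
    θ-solution-zero cancel T Z T₀≈0 Z₀≈0 θZ≋TZ n = below n n ℕ.≤-refl
      where
      below : ∀ n k → k ≤ n → Z k ≈ 0#
      below zero    .zero z≤n = Z₀≈0
      below (suc n) k k≤1+n with k ≤? n
      ... | yes k≤n = below n k k≤n
      ... | no k≰n with ℕ.≤-antisym k≤1+n (ℕ.≰⇒> k≰n)
      ... | ≡.refl = cancel n (begin
        suc n × Z (suc n)                                          ≈⟨ θZ≋TZ (suc n) ⟩
        (T ⊛ Z) (suc n)                                            ≈⟨ ⊛-coeff T Z (suc n) ⟩
        ∑[ i < suc (suc n) ] (T i * Z (suc n ∸ i))                  ≈⟨ ∑-shift (suc n) _ ⟩
        T 0 * Z (suc n) + ∑[ i < suc n ] (T (suc i) * Z (n ∸ i))    ≈⟨ +-cong (trans (*-congʳ T₀≈0) (zeroˡ _))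
                                                                             (∑-zero (suc n) λ i _ →
                                                                               trans (*-congˡ (below n (n ∸ i) (ℕ.m∸n≤m n i))) (zeroʳ _)) ⟩
        0# + 0#                                                    ≈⟨ +-identityˡ 0# ⟩
        0#                                                         ∎)

    θ-solution-unique : NatTorsionFree → ∀ {T V A B} → T 0 ≈ 0# → A 0 ≈ B 0 →
                        θ A ≋ V ⊕ T ⊛ A → θ B ≋ V ⊕ T ⊛ B → A ≋ B
    θ-solution-unique cancel {T} {V} {A} {B} T₀≈0 A₀≈B₀ θA θB =
      SeriesRing.x∙y⁻¹≈ε⇒x≈y A B (θ-solution-zero cancel T (A ⊕ ⊝ B) T₀≈0 (-‿inverseʳ-≈ A₀≈B₀) θdiff)
      where
      -‿inverseʳ-≈ : A 0 ≈ B 0 → A 0 + - B 0 ≈ 0#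
      -‿inverseʳ-≈ eq = trans (+-congʳ eq) (-‿inverseʳ (B 0))
      cancelˡ : ∀ v x y → (v + x) + - (v + y) ≈ x + - y
      cancelˡ v x y = begin
        (v + x) + - (v + y)      ≈⟨ +-congˡ (-‿+-comm v y) ⟨
        (v + x) + (- v + - y)    ≈⟨ interchange v x (- v) (- y) ⟩
        (v + - v) + (x + - y)    ≈⟨ +-congʳ (-‿inverseʳ v) ⟩
        0# + (x + - y)           ≈⟨ +-identityˡ _ ⟩
        x + - y                  ∎
      θdiff : θ (A ⊕ ⊝ B) ≋ T ⊛ (A ⊕ ⊝ B)
      θdiff n = begin
        θ (A ⊕ ⊝ B) n                                  ≈⟨ trans (θ-⊕ A (⊝ B) n) (+-congˡ (θ-neg B n)) ⟩
        θ A n + - θ B n                                ≈⟨ +-cong (θA n) (-‿cong (θB n)) ⟩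
        (V n + (T ⊛ A) n) + - (V n + (T ⊛ B) n)        ≈⟨ cancelˡ (V n) _ _ ⟩
        (T ⊛ A) n + - (T ⊛ B) n                        ≈⟨ SeriesRing.x[y-z]≈xy-xz T A B n ⟨
        (T ⊛ (A ⊕ ⊝ B)) n                              ∎

  module Lift {d : Carrier → Carrier} (d-isDerivation : IsDerivation R d) where

    open IsDerivation d-isDerivation renaming (cong to d-cong)

    d-0 : d 0# ≈ 0#
    d-0 = +-identityˡ-unique (d 0#) (d 0#) (sym (trans (d-cong (sym (+-identityˡ 0#))) (+-homo 0# 0#)))

    lift : Series → Series
    lift f n = d (f n)

    opaque
      unfolding _⊕_

      lift-isDerivation : IsDerivation seriesRing lift
      lift-isDerivation = record
        { cong    = λ f≋g n → d-cong (f≋g n)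
        ; +-homo  = λ f g n → +-homo (f n) (g n)
        ; leibniz = λ f g n → begin
            d ((f ⊛ g) n)                                  ≈⟨ d-cong (⊛-coeff f g n) ⟩
            d (∑[ i < suc n ] (f i * g (n ∸ i)))            ≈⟨ d-∑ (suc n) _ ⟩
            ∑[ i < suc n ] d (f i * g (n ∸ i))              ≈⟨ ∑-cong (suc n) (λ i → leibniz (f i) _) ⟩
            ∑[ i < suc n ] (d (f i) * g (n ∸ i) + f i * d (g (n ∸ i)))
                                                           ≈⟨ ∑-distrib-+ (suc n) _ _ ⟩
            ∑[ i < suc n ] (d (f i) * g (n ∸ i)) + ∑[ i < suc n ] (f i * d (g (n ∸ i)))
                                                           ≈⟨ +-cong (⊛-coeff (lift f) g n) (⊛-coeff f (lift g) n) ⟨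
            (lift f ⊛ g ⊕ f ⊛ lift g) n                    ∎ }
        where
        d-∑ : ∀ k h → d (∑< k h) ≈ ∑[ i < k ] d (h i)
        d-∑ zero    h = d-0
        d-∑ (suc k) h = trans (+-homo _ _) (+-congʳ (d-∑ k h))

      lift-θ : ∀ f → lift (θ f) ≋ θ (lift f)
      lift-θ f n = d-× n (f n)
        where
        d-× : ∀ m a → d (m × a) ≈ m × d a
        d-× zero    a = d-0
        d-× (suc m) a = trans (+-homo a (m × a)) (+-congˡ (d-× m a))

      lift-κ : ∀ a → lift (κ a) ≋ κ (d a)
      lift-κ a zero    = refl
      lift-κ a (suc n) = d-0

ℚ-ring : CommutativeRing _ _
ℚ-ring = ℚ.+-*-commutativeRing

module ℚ⟦x⟧ = PowerSeries ℚ-ring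
module ℚ⟦x⟧⟦q⟧ = PowerSeries ℚ⟦x⟧.seriesRing

module RationalArithmetic where

  open import Data.Nat using (zero; suc)
  open import Data.Integer as ℤ using (+_)
  open import Data.Integer.Tactic.RingSolver using (solve-∀)
  open import Data.Rational using (0ℚ; 1ℚ; _/_; _*_; toℚᵘ)
  import Data.Rational.Unnormalised as ℚᵘ
  import Data.Rational.Unnormalised.Properties as ℚᵘ
  open import Relation.Binary.PropositionalEquality as ≡ using (_≡_; cong; trans)
  open import Algebra.Properties.Semiring.Mult (CommutativeRing.semiring ℚ-ring) public
    using (_×_; ×-assoc-*; ×-comm-*)
  open ≡.≡-Reasoning

  private
    toℚᵘ-/ : ∀ a m → toℚᵘ (a / suc m) ℚᵘ.≃ ℚᵘ.mkℚᵘ a m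
    toℚᵘ-/ a m = ℚ.toℚᵘ-fromℚᵘ (ℚᵘ.mkℚᵘ a m)

  ×1≡/1 : ∀ n → n × 1ℚ ≡ + n / 1
  ×1≡/1 zero    = ≡.refl
  ×1≡/1 (suc n) = ℚ.toℚᵘ-injective (ℚᵘ.≃-trans (ℚ.toℚᵘ-homo-+ 1ℚ (n × 1ℚ))
    (ℚᵘ.≃-trans (ℚᵘ.+-cong (toℚᵘ-/ (+ 1) 0) (ℚᵘ.≃-trans (ℚᵘ.≃-reflexive (cong toℚᵘ (×1≡/1 n))) (toℚᵘ-/ (+ n) 0)))
    (ℚᵘ.≃-trans (ℚᵘ.*≡* (cross (+ n))) (ℚᵘ.≃-sym (toℚᵘ-/ (+ suc n) 0)))))
    where
    cross : ∀ x → (+ 1 ℤ.* + 1 ℤ.+ x ℤ.* + 1) ℤ.* + 1 ≡ (+ 1 ℤ.+ x) ℤ.* (+ 1 ℤ.* + 1)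
    cross = solve-∀

  ×≡/1* : ∀ n a → n × a ≡ (+ n / 1) * a
  ×≡/1* n a = begin
    n × a           ≡⟨ cong (n ×_) (ℚ.*-identityˡ a) ⟨
    n × (1ℚ * a)    ≡⟨ ×-assoc-* n 1ℚ a ⟨
    (n × 1ℚ) * a    ≡⟨ cong (_* a) (×1≡/1 n) ⟩
    (+ n / 1) * a   ∎

  ×-/ : ∀ m a → suc m × (+ a / suc m) ≡ + a / 1
  ×-/ m a = trans (×≡/1* (suc m) (+ a / suc m)) (ℚ.toℚᵘ-injective
    (ℚᵘ.≃-trans (ℚ.toℚᵘ-homo-* (+ suc m / 1) (+ a / suc m))
    (ℚᵘ.≃-trans (ℚᵘ.*-cong (toℚᵘ-/ (+ suc m) 0) (toℚᵘ-/ (+ a) m))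
    (ℚᵘ.≃-trans (ℚᵘ.*≡* (cross (+ a) (+ suc m))) (ℚᵘ.≃-sym (toℚᵘ-/ (+ a) 0))))))
    where
    cross : ∀ (x y : ℤ.ℤ) → (y ℤ.* x) ℤ.* + 1 ≡ x ℤ.* (+ 1 ℤ.* y)
    cross = solve-∀

  ×-torsionFree : ∀ m {a} → suc m × a ≡ 0ℚ → a ≡ 0ℚ
  ×-torsionFree m {a} m×a≡0 = begin
    a                                  ≡⟨ ℚ.*-identityˡ a ⟨
    1ℚ * a                             ≡⟨ cong (_* a) (×-/ m 1) ⟨
    (suc m × (+ 1 / suc m)) * a        ≡⟨ ×-assoc-* (suc m) (+ 1 / suc m) a ⟩
    suc m × ((+ 1 / suc m) * a)        ≡⟨ ×-comm-* (suc m) (+ 1 / suc m) a ⟨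
    (+ 1 / suc m) * (suc m × a)        ≡⟨ cong ((+ 1 / suc m) *_) m×a≡0 ⟩
    (+ 1 / suc m) * 0ℚ                 ≡⟨ ℚ.*-zeroʳ (+ 1 / suc m) ⟩
    0ℚ                                 ∎

  ℚ⟦x⟧-torsionFree : ℚ⟦x⟧⟦q⟧.NatTorsionFree
  ℚ⟦x⟧-torsionFree m m×a≈0 i = ×-torsionFree m (trans (≡.sym (ℚ⟦x⟧.×-coeff (suc m) _ i)) (m×a≈0 i))

module PolynomialCoefficients where

  open import Defs
  open import Data.Nat using (ℕ; zero; suc; _∸_; _+_)
  import Data.Nat.Properties as ℕ
  open import Data.Integer using (+_)
  open import Data.Rational as ℚ using (ℚ; 0ℚ; 1ℚ; _/_)
  open import Data.List using ([]; _∷_)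
  open import Relation.Binary.PropositionalEquality as ≡ using (_≡_; refl; cong; sym; trans)
  open ℚ⟦x⟧ using (_≋_; _⊕_; _⊛_; ⊝_; κ; 𝟙; q^_; ∂; ⊕-coeff; ⊝-coeff; ⊛-coeff; κ⊛; ∑<; ∑-shift; ∑-zero)
  open RationalArithmetic using (×≡/1*)

  coeff-+P : ∀ p q → coeff (p +P q) ≋ coeff p ⊕ coeff q
  coeff-+P p q i = trans (pointwise p q i) (sym (⊕-coeff (coeff p) (coeff q) i))
    where
    pointwise : ∀ p q i → coeff (p +P q) i ≡ coeff p i ℚ.+ coeff q i
    pointwise []      q       i       = sym (ℚ.+-identityˡ _)
    pointwise (a ∷ p) []      zero    = sym (ℚ.+-identityʳ _)
    pointwise (a ∷ p) []      (suc i) = sym (ℚ.+-identityʳ _)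
    pointwise (a ∷ p) (b ∷ q) zero    = refl
    pointwise (a ∷ p) (b ∷ q) (suc i) = pointwise p q i

  coeff-·P : ∀ a p → coeff (a ·P p) ≋ κ a ⊛ coeff p
  coeff-·P a p i = trans (scale p i) (sym (κ⊛ a (coeff p) i))
    where
    scale : ∀ p i → coeff (a ·P p) i ≡ a ℚ.* coeff p i
    scale []      i       = sym (ℚ.*-zeroʳ a)
    scale (b ∷ p) zero    = refl
    scale (b ∷ p) (suc i) = scale p i

  coeff-*P : ∀ p q → coeff (p *P q) ≋ coeff p ⊛ coeff q
  coeff-*P []      q i = sym (trans (⊛-coeff _ (coeff q) i) (∑-zero (suc i) λ j _ → ℚ.*-zeroˡ (coeff q (i ∸ j))))
  coeff-*P (a ∷ p) q i = begin
    coeff (a ·P q +P (0ℚ ∷ p *P q)) i                      ≡⟨ trans (coeff-+P (a ·P q) _ i) (⊕-coeff _ _ i) ⟩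
    coeff (a ·P q) i ℚ.+ coeff (0ℚ ∷ p *P q) i             ≡⟨ ≡.cong₂ ℚ._+_ (trans (coeff-·P a q i) (κ⊛ a (coeff q) i)) (tail i) ⟩
    a ℚ.* coeff q i ℚ.+ ∑< i (λ j → coeff p j ℚ.* coeff q (i ∸ suc j))
                                                           ≡⟨ ∑-shift i (λ j → coeff (a ∷ p) j ℚ.* coeff q (i ∸ j)) ⟨
    ∑< (suc i) (λ j → coeff (a ∷ p) j ℚ.* coeff q (i ∸ j)) ≡⟨ ⊛-coeff (coeff (a ∷ p)) (coeff q) i ⟨
    (coeff (a ∷ p) ⊛ coeff q) i                            ∎
    where
    open ≡.≡-Reasoning
    tail : ∀ i → coeff (0ℚ ∷ p *P q) i ≡ ∑< i (λ j → coeff p j ℚ.* coeff q (i ∸ suc j))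
    tail zero    = refl
    tail (suc i) = trans (coeff-*P p q i) (⊛-coeff (coeff p) (coeff q) i)

  coeff-negP : ∀ p → coeff (negP p) ≋ ⊝ coeff p
  coeff-negP p i = trans (coeff-·P (ℚ.- 1ℚ) p i) (trans (κ⊛ (ℚ.- 1ℚ) (coeff p) i)
                     (trans (-1*x≈-x (coeff p i)) (sym (⊝-coeff (coeff p) i))))
    where open import Algebra.Properties.Ring (Algebra.CommutativeRing.ring ℚ-ring) using (-1*x≈-x)

  coeff-1P : coeff 1P ≋ 𝟙
  coeff-1P zero    = refl
  coeff-1P (suc i) = refl

  coeff-X : coeff X ≋ q^ 1
  coeff-X zero          = refl
  coeff-X (suc zero)    = refl
  coeff-X (suc (suc i)) = refl

  coeff-constP : ∀ a → coeff (constP a) ≋ κ a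
  coeff-constP a zero    = refl
  coeff-constP a (suc i) = refl

  coeff-deriv : ∀ p → coeff (deriv p) ≋ ∂ (coeff p)
  coeff-deriv []      i = sym (ℚ⟦x⟧.×-zeroʳ (suc i))
  coeff-deriv (a ∷ p) i = trans (coeff-derivAux 1 p i) (sym (×≡/1* (suc i) (coeff p i)))
    where
    coeff-derivAux : ∀ k p i → coeff (derivAux k p) i ≡ (+ (k + i) / 1) ℚ.* coeff p i
    coeff-derivAux k []      i       = sym (ℚ.*-zeroʳ (+ (k + i) / 1))
    coeff-derivAux k (a ∷ p) zero    = cong (λ m → (+ m / 1) ℚ.* a) (sym (ℕ.+-identityʳ k))
    coeff-derivAux k (a ∷ p) (suc i) = trans (coeff-derivAux (suc k) p i)
                                             (cong (λ m → (+ m / 1) ℚ.* coeff p i) (sym (ℕ.+-suc k i)))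

module SeriesCoefficients where

  open import Defs
  open import Data.Nat using (ℕ; zero; suc; _∸_; _<_; _≟_; s≤s)
  import Data.Nat.Properties as ℕ
  open import Data.List as List using ([]; _∷_; [_]; _++_; applyUpTo)
  import Data.List.Properties as List
  open import Data.Sum using (inj₁; inj₂)
  open import Data.Bool using (if_then_else_)
  open import Function using (_∘_; id)
  open import Relation.Nullary using (Dec; does; yes; no)
  open import Relation.Binary.PropositionalEquality as ≡ using (_≡_; cong)
  open import Algebra.Properties.Semiring.Exp (CommutativeRing.semiring ℚ⟦x⟧⟦q⟧.seriesRing) using (_^_)
  open PolynomialCoefficients
  open CommutativeRing ℚ⟦x⟧⟦q⟧.seriesRing
  open ℚ⟦x⟧⟦q⟧ using (∑<; ∑-shift; ∑-cong; ∑-cong<; ⊛-coeff; q^_; indicator)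
  open ℚ⟦x⟧ using (_≋_; _⊛_; 𝟙)
  private module ℚx = CommutativeRing ℚ⟦x⟧.seriesRing

  ⟦_⟧ : Series → ℚ⟦x⟧⟦q⟧.Series
  ⟦ f ⟧ n = coeff (f n)

  map-applyUpTo : ∀ {A B : Set} (h : A → B) g n → List.map h (applyUpTo g n) ≡ applyUpTo (h ∘ g) n
  map-applyUpTo h g zero    = ≡.refl
  map-applyUpTo h g (suc n) = cong (h (g 0) ∷_) (map-applyUpTo h (g ∘ suc) n)

  coeff-sumP : ∀ (g : ℕ → Poly) n → coeff (sumP (applyUpTo g n)) ≋ ∑< n (coeff ∘ g)
  coeff-sumP g zero    i = ≡.refl
  coeff-sumP g (suc n) i = ℚx.trans (coeff-+P (g 0) _) (ℚx.trans (ℚx.+-congˡ (coeff-sumP (g ∘ suc) n))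
                                   (ℚx.sym (∑-shift n (coeff ∘ g)))) i

  coeff-sumFrom1 : ∀ n (f : ℕ → Poly) → coeff (sumFrom1 n f) ≋ ∑< n (coeff ∘ f ∘ suc)
  coeff-sumFrom1 n f = coeff-sumP (f ∘ suc) n

  coeff-prodP : ∀ (g : ℕ → Poly) n → coeff (prodP (applyUpTo g (suc n))) ≋ coeff (prodP (applyUpTo g n)) ⊛ coeff (g n)
  coeff-prodP g zero = ℚx.trans (coeff-*P (g 0) 1P) (ℚx.trans (ℚx.*-congˡ coeff-1P)
                         (ℚx.trans (ℚx.*-comm (coeff (g 0)) 𝟙) (ℚx.*-congʳ (ℚx.sym coeff-1P))))
  coeff-prodP g (suc n) = ℚx.trans (coeff-*P (g 0) _) (ℚx.trans (ℚx.*-congˡ (coeff-prodP (g ∘ suc) n))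
    (ℚx.trans (ℚx.sym (ℚx.*-assoc (coeff (g 0)) _ _)) (ℚx.*-congʳ (ℚx.sym (coeff-*P (g 0) (prodP (applyUpTo (g ∘ suc) n)))))))

  ⟦*S⟧ : ∀ f g → ⟦ f *S g ⟧ ≈ ⟦ f ⟧ * ⟦ g ⟧
  ⟦*S⟧ f g n = ℚx.trans (ℚx.reflexive (cong (coeff ∘ sumP) (map-applyUpTo (λ i → f i *P g (n ∸ i)) id (suc n))))
    (ℚx.trans (coeff-sumP (λ i → f i *P g (n ∸ i)) (suc n))
    (ℚx.trans (∑-cong (suc n) (λ i → coeff-*P (f i) (g (n ∸ i)))) (ℚx.sym (⊛-coeff ⟦ f ⟧ ⟦ g ⟧ n))))

  ⟦+S⟧ : ∀ f g → ⟦ f +S g ⟧ ≈ ⟦ f ⟧ + ⟦ g ⟧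
  ⟦+S⟧ f g n = ℚx.trans (coeff-+P (f n) (g n)) (ℚx.sym (ℚ⟦x⟧⟦q⟧.⊕-coeff ⟦ f ⟧ ⟦ g ⟧ n))

  ⟦-S⟧ : ∀ f g → ⟦ f -S g ⟧ ≈ ⟦ f ⟧ - ⟦ g ⟧
  ⟦-S⟧ f g n = ℚx.trans (coeff-+P (f n) _) (ℚx.trans (ℚx.+-congˡ (ℚx.trans (coeff-negP (g n))
                 (ℚx.sym (ℚ⟦x⟧⟦q⟧.⊝-coeff ⟦ g ⟧ n)))) (ℚx.sym (ℚ⟦x⟧⟦q⟧.⊕-coeff ⟦ f ⟧ _ n)))

  ⟦oneS⟧ : ⟦ oneS ⟧ ≈ 1#
  ⟦oneS⟧ zero    = coeff-1P
  ⟦oneS⟧ (suc n) i = ≡.refl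

  ⟦qPow⟧ : ∀ k → ⟦ qPow k ⟧ ≈ q^ k
  ⟦qPow⟧ k n = bit (n ≟ k)
    where
    bit : ∀ {A : Set} (d : Dec A) → coeff (if does d then 1P else 0P) ≋ indicator d
    bit (yes _) = coeff-1P
    bit (no _)  = λ i → ≡.refl

  ⟦^S⟧ : ∀ f k → ⟦ f ^S k ⟧ ≈ ⟦ f ⟧ ^ k
  ⟦^S⟧ f zero    = ⟦oneS⟧
  ⟦^S⟧ f (suc k) = trans (⟦*S⟧ f (f ^S k)) (*-congˡ (⟦^S⟧ f k))

  module _ (step : ℕ → (ℕ → Poly) → Poly) where

    table-length : ∀ n → List.length (table step n) ≡ n
    table-length zero    = ≡.refl
    table-length (suc n) = ≡.trans (List.length-++ (table step n)) (≡.trans (ℕ.+-comm _ 1) (cong suc (table-length n)))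

    strongRec-unfold : ∀ n → strongRec step n ≡ step n (nth (table step n))
    strongRec-unfold n = ≡.trans (cong (nth (table step (suc n))) (≡.sym (table-length n))) (nth-last (table step n))
      where
      nth-last : ∀ xs {a} → nth (xs ++ [ a ]) (List.length xs) ≡ a
      nth-last []       = ≡.refl
      nth-last (x ∷ xs) = nth-last xs

    nth-table : ∀ n i → i < n → nth (table step n) i ≡ strongRec step i
    nth-table (suc n) i (s≤s i≤n) with ℕ.m≤n⇒m<n∨m≡n i≤n
    ... | inj₁ i<n  = ≡.trans (nth-init (table step n) i (≡.subst (i <_) (≡.sym (table-length n)) i<n)) (nth-table n i i<n)
      where
      nth-init : ∀ xs {a} i → i < List.length xs → nth (xs ++ [ a ]) i ≡ nth xs i
      nth-init (x ∷ xs) zero    _         = ≡.refl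
      nth-init (x ∷ xs) (suc i) (s≤s i<) = nth-init xs i i<
    ... | inj₂ ≡.refl = ≡.refl

  ⟦invS⟧-suc : ∀ f n → ⟦ invS f ⟧ (suc n) ℚx.≈ ℚx.- ∑[ j < suc n ] (⟦ f ⟧ (suc j) ℚx.* ⟦ invS f ⟧ (n ∸ j))
  ⟦invS⟧-suc f n = recurrence _ (λ _ _ → ≡.refl)
    where
    recurrence : ∀ step → (∀ n prev → step (suc n) prev ≡ negP (sumFrom1 (suc n) (λ i → f i *P prev (suc n ∸ i)))) →
      coeff (strongRec step (suc n)) ℚx.≈ ℚx.- ∑[ j < suc n ] (⟦ f ⟧ (suc j) ℚx.* coeff (strongRec step (n ∸ j)))
    recurrence step step-suc = ℚx.trans (ℚx.reflexive (cong coeff (≡.trans (strongRec-unfold step (suc n)) (step-suc n prev))))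
      (ℚx.trans (coeff-negP (sumFrom1 (suc n) terms)) (ℚx.-‿cong (ℚx.trans (coeff-sumFrom1 (suc n) terms)
        (∑-cong< (suc n) λ j j<1+n → ℚx.trans (coeff-*P (f (suc j)) (prev (n ∸ j)))
          (ℚx.*-congˡ (ℚx.reflexive (cong coeff (nth-table step (suc n) (n ∸ j) (s≤s (ℕ.m∸n≤m n j))))))))))
      where
      prev : ℕ → Poly
      prev = nth (table step (suc n))
      terms : ℕ → Poly
      terms i = f i *P prev (suc n ∸ i)

  ⟦invS⟧ : ∀ f → ⟦ f ⟧ 0 ℚx.≈ ℚx.1# → ⟦ f ⟧ * ⟦ invS f ⟧ ≈ 1#
  ⟦invS⟧ f f₀≈1 zero = begin
    (⟦ f ⟧ * ⟦ invS f ⟧) 0                 ≈⟨ ⊛-coeff ⟦ f ⟧ _ 0 ⟩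
    ℚx.0# ℚx.+ ⟦ f ⟧ 0 ℚx.* ⟦ invS f ⟧ 0      ≈⟨ ℚx.+-identityˡ _ ⟩
    ⟦ f ⟧ 0 ℚx.* ⟦ invS f ⟧ 0               ≈⟨ ℚx.*-cong f₀≈1 coeff-1P ⟩
    ℚx.1# ℚx.* ℚx.1#                          ≈⟨ ℚx.*-identityˡ ℚx.1# ⟩
    ℚx.1#                                   ∎
    where open import Relation.Binary.Reasoning.Setoid ℚx.setoid
  ⟦invS⟧ f f₀≈1 (suc n) = begin
    (⟦ f ⟧ * ⟦ invS f ⟧) (suc n)
      ≈⟨ ⊛-coeff ⟦ f ⟧ _ (suc n) ⟩
    ∑[ i < suc (suc n) ] (⟦ f ⟧ i ℚx.* ⟦ invS f ⟧ (suc n ∸ i))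
      ≈⟨ ∑-shift (suc n) _ ⟩
    ⟦ f ⟧ 0 ℚx.* ⟦ invS f ⟧ (suc n) ℚx.+ Rest
      ≈⟨ ℚx.+-congʳ (ℚx.trans (ℚx.*-cong f₀≈1 (⟦invS⟧-suc f n)) (ℚx.*-identityˡ _)) ⟩
    ℚx.- Rest ℚx.+ Rest
      ≈⟨ ℚx.-‿inverseˡ Rest ⟩
    ℚx.0# ∎
    where
    open import Relation.Binary.Reasoning.Setoid ℚx.setoid
    Rest : ℚ⟦x⟧.Series
    Rest = ∑[ j < suc n ] (⟦ f ⟧ (suc j) ℚx.* ⟦ invS f ⟧ (n ∸ j))

module InverseSeries where

  open CommutativeRing ℚ⟦x⟧⟦q⟧.seriesRing
  open ℚ⟦x⟧⟦q⟧ using (θ; θ-⊛; θ-κ)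
  open import Algebra.Properties.Ring ring using (+-inverseʳ-unique; -‿distribʳ-*)
  open import Relation.Binary.Reasoning.Setoid setoid

  *-inverse-unique : ∀ a {b c} → a * b ≈ 1# → a * c ≈ 1# → b ≈ c
  *-inverse-unique a {b} {c} ab≈1 ac≈1 = begin
    b              ≈⟨ *-identityˡ b ⟨
    1# * b         ≈⟨ *-congʳ ac≈1 ⟨
    (a * c) * b    ≈⟨ *-congʳ (*-comm a c) ⟩
    (c * a) * b    ≈⟨ *-assoc c a b ⟩
    c * (a * b)    ≈⟨ *-congˡ ab≈1 ⟩
    c * 1#         ≈⟨ *-identityʳ c ⟩
    c              ∎

  θ-inverse : ∀ {a b} → a * b ≈ 1# → θ b ≈ - (b * θ a * b)
  θ-inverse {a} {b} ab≈1 = begin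
    θ b                      ≈⟨ *-identityˡ (θ b) ⟨
    1# * θ b                 ≈⟨ *-congʳ (trans (*-comm b a) ab≈1) ⟨
    (b * a) * θ b            ≈⟨ *-assoc b a (θ b) ⟩
    b * (a * θ b)            ≈⟨ *-congˡ (+-inverseʳ-unique (θ a * b) (a * θ b) leibniz) ⟩
    b * - (θ a * b)          ≈⟨ -‿distribʳ-* b (θ a * b) ⟨
    - (b * (θ a * b))        ≈⟨ -‿cong (*-assoc b (θ a) b) ⟨
    - (b * θ a * b)          ∎
    where
    leibniz : θ a * b + a * θ b ≈ 0#
    leibniz = trans (sym (θ-⊛ a b)) (trans (ℚ⟦x⟧⟦q⟧.θ-cong ab≈1) (θ-κ _))

module OverpartitionProduct where

  open import Defs
  open import Data.Nat using (ℕ; zero; suc; _<_) renaming (_+_ to _+ℕ_; _*_ to _*ℕ_)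
  import Data.Nat.Properties as ℕ
  open import Function using (_∘_)
  open import Relation.Binary.PropositionalEquality as ≡ using ()
  import Algebra.Properties.Ring

  open SeriesCoefficients
  open InverseSeries
  open CommutativeRing ℚ⟦x⟧⟦q⟧.seriesRing
  open ℚ⟦x⟧⟦q⟧ using (θ; θ-cong; θ-⊛; θ-⊕; θ-neg; θ-κ; θ-q^; q^_; q^-+; geom; geom-inverse; geom-coeff-<;
                      ⊕-coeff; ⊝-coeff; ⊛q^-coeff-<)
  private module ℚx = CommutativeRing ℚ⟦x⟧.seriesRing
  private module ℚxRing = Algebra.Properties.Ring ℚx.ring
  private module ∑q = FiniteSum commutativeSemiring
  open import Algebra.Properties.Ring ring using (-‿distribʳ-*; -‿distribˡ-*; -‿involutive; x[y-z]≈xy-xz)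
  open import Algebra.Properties.CommutativeSemigroup +-commutativeSemigroup using (interchange)
  open import Algebra.Properties.CommutativeSemigroup *-commutativeSemigroup using (x∙yz≈y∙xz)
  open import Algebra.Properties.Semiring.Mult semiring using (_×_; ×-assoc-*; ×-congʳ)
  open import Algebra.Properties.Monoid.Mult +-monoid using (×-assocˡ)
  open import Relation.Binary.Reasoning.Setoid setoid

  factor : ℕ → ℚ⟦x⟧⟦q⟧.Series
  factor n = (1# + q^ n) * ⟦ invS (oneS -S qPow n) ⟧

  -- The logarithmic derivative 2n ∑_{k odd} q^{nk} of (1 + q^n)/(1 - q^n).
  factorLogDerivative : ℕ → ℚ⟦x⟧⟦q⟧.Series
  factorLogDerivative n = (2 *ℕ n) × (q^ n * geom (2 *ℕ n))

  module _ (m : ℕ) where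

    private
      n : ℕ
      n = suc m
      u g : ℚ⟦x⟧⟦q⟧.Series
      u = q^ n
      g = ⟦ invS (oneS -S qPow n) ⟧

    1-q^n-inverse : (1# - q^ n) * g ≈ 1#
    1-q^n-inverse = trans (*-congʳ (sym ⟦1-q^n⟧)) (⟦invS⟧ (oneS -S qPow n) constant)
      where
      ⟦1-q^n⟧ : ⟦ oneS -S qPow n ⟧ ≈ 1# - q^ n
      ⟦1-q^n⟧ = trans (⟦-S⟧ oneS (qPow n)) (+-cong ⟦oneS⟧ (-‿cong (⟦qPow⟧ n)))
      constant : ⟦ oneS -S qPow n ⟧ 0 ℚx.≈ ℚx.1#
      constant = ℚx.trans (⟦1-q^n⟧ 0) (ℚx.trans (⊕-coeff 1# (- u) 0)
                   (ℚx.trans (ℚx.+-congˡ (ℚx.trans (⊝-coeff u 0) ℚxRing.-0#≈0#)) (ℚx.+-identityʳ ℚx.1#)))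

    geom≈inverse : geom n ≈ g
    geom≈inverse = *-inverse-unique (1# - u) (trans (*-comm _ (geom n)) (geom-inverse m)) 1-q^n-inverse

    geom-2n*[1+q^n]≈inverse : geom (2 *ℕ n) * (1# + u) ≈ g
    geom-2n*[1+q^n]≈inverse = *-inverse-unique (1# - u) inverse 1-q^n-inverse
      where
      u*u≈q^2n : u * u ≈ q^ (2 *ℕ n)
      u*u≈q^2n = trans (q^-+ n n) (reflexive (≡.cong q^_ (≡.cong (n +ℕ_) (≡.sym (ℕ.+-identityʳ n)))))
      difference-of-squares : (1# + u) * (1# - u) ≈ 1# - u * u
      difference-of-squares = begin
        (1# + u) * (1# - u)                ≈⟨ distribʳ _ 1# u ⟩
        1# * (1# - u) + u * (1# - u)       ≈⟨ +-cong (*-identityˡ _) (x[y-z]≈xy-xz u 1# u) ⟩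
        (1# - u) + (u * 1# - u * u)        ≈⟨ +-congˡ (+-congʳ (*-identityʳ u)) ⟩
        (1# - u) + (u - u * u)             ≈⟨ +-assoc 1# (- u) _ ⟩
        1# + (- u + (u - u * u))           ≈⟨ +-congˡ (+-assoc (- u) u _) ⟨
        1# + ((- u + u) - u * u)           ≈⟨ +-congˡ (+-congʳ (-‿inverseˡ u)) ⟩
        1# + (0# - u * u)                  ≈⟨ +-congˡ (+-identityˡ _) ⟩
        1# - u * u                         ∎
      inverse : (1# - u) * (geom (2 *ℕ n) * (1# + u)) ≈ 1#
      inverse = begin
        (1# - u) * (geom (2 *ℕ n) * (1# + u))     ≈⟨ x∙yz≈y∙xz (1# - u) _ _ ⟩
        geom (2 *ℕ n) * ((1# - u) * (1# + u))     ≈⟨ *-congˡ (trans (*-comm _ _) difference-of-squares) ⟩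
        geom (2 *ℕ n) * (1# - u * u)              ≈⟨ *-congˡ (+-congˡ (-‿cong u*u≈q^2n)) ⟩
        geom (2 *ℕ n) * (1# - q^ (2 *ℕ n))        ≈⟨ geom-inverse (m +ℕ suc (m +ℕ 0)) ⟩
        1#                                        ∎

    θ-inverse-1-q^n : θ g ≈ g * (n × u) * g
    θ-inverse-1-q^n = begin
      θ g                                ≈⟨ θ-inverse 1-q^n-inverse ⟩
      - (g * θ (1# - u) * g)             ≈⟨ -‿cong (*-congʳ (*-congˡ θ[1-u])) ⟩
      - (g * - (n × u) * g)              ≈⟨ -‿cong (*-congʳ (-‿distribʳ-* g (n × u))) ⟨
      - (- (g * (n × u)) * g)            ≈⟨ -‿cong (-‿distribˡ-* (g * (n × u)) g) ⟨
      - - (g * (n × u) * g)              ≈⟨ -‿involutive _ ⟩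
      g * (n × u) * g                    ∎
      where
      θ[1-u] : θ (1# - u) ≈ - (n × u)
      θ[1-u] = trans (θ-⊕ 1# (- u)) (trans (+-cong (θ-κ ℚx.1#) (trans (θ-neg u) (-‿cong (θ-q^ n))))
                 (+-identityˡ _))

    θ-factor : θ (factor n) ≈ factorLogDerivative n * factor n
    θ-factor = begin
      θ ((1# + u) * g)                            ≈⟨ θ-⊛ (1# + u) g ⟩
      θ (1# + u) * g + (1# + u) * θ g             ≈⟨ +-cong (*-congʳ θ[1+u]) (*-congˡ θ-inverse-1-q^n) ⟩
      w * g + (1# + u) * (g * w * g)              ≈⟨ +-congˡ (x∙yz≈y∙xz (1# + u) (g * w) g) ⟩
      w * g + (g * w) * ((1# + u) * g)            ≈⟨ +-congˡ (*-congʳ (*-comm g w)) ⟩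
      w * g + (w * g) * ((1# + u) * g)            ≈⟨ +-congʳ (*-identityʳ (w * g)) ⟨
      (w * g) * 1# + (w * g) * ((1# + u) * g)     ≈⟨ distribˡ (w * g) 1# _ ⟨
      (w * g) * (1# + (1# + u) * g)               ≈⟨ *-congˡ (+-congʳ 1-q^n-inverse) ⟨
      (w * g) * ((1# - u) * g + (1# + u) * g)     ≈⟨ *-congˡ (distribʳ g (1# - u) (1# + u)) ⟨
      (w * g) * (((1# - u) + (1# + u)) * g)       ≈⟨ *-congˡ (*-congʳ two) ⟩
      (w * g) * ((2 × 1#) * g)                    ≈⟨ x∙yz≈y∙xz (w * g) (2 × 1#) g ⟩
      (2 × 1#) * ((w * g) * g)                    ≈⟨ trans (×-assoc-* 2 1# _) (×-congʳ 2 (*-identityˡ _)) ⟩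
      2 × ((w * g) * g)                           ≈⟨ ×-congʳ 2 (*-assoc w g g) ⟩
      2 × (w * (g * g))                           ≈⟨ ×-congʳ 2 (*-congˡ (*-congʳ geom-2n*[1+q^n]≈inverse)) ⟨
      2 × (w * ((geom (2 *ℕ n) * (1# + u)) * g))  ≈⟨ ×-congʳ 2 (*-congˡ (*-assoc _ _ g)) ⟩
      2 × ((n × u) * (geom (2 *ℕ n) * factor n))  ≈⟨ ×-congʳ 2 (×-assoc-* n u _) ⟩
      2 × (n × (u * (geom (2 *ℕ n) * factor n)))  ≈⟨ ×-assocˡ _ 2 n ⟩
      (2 *ℕ n) × (u * (geom (2 *ℕ n) * factor n)) ≈⟨ ×-congʳ (2 *ℕ n) (*-assoc u _ _) ⟨
      (2 *ℕ n) × ((u * geom (2 *ℕ n)) * factor n) ≈⟨ ×-assoc-* (2 *ℕ n) _ _ ⟨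
      factorLogDerivative n * factor n            ∎
      where
      w : ℚ⟦x⟧⟦q⟧.Series
      w = n × u
      θ[1+u] : θ (1# + u) ≈ w
      θ[1+u] = trans (θ-⊕ 1# u) (trans (+-cong (θ-κ ℚx.1#) (θ-q^ n)) (+-identityˡ w))
      two : (1# - u) + (1# + u) ≈ 2 × 1#
      two = begin
        (1# - u) + (1# + u)          ≈⟨ interchange 1# (- u) 1# u ⟩
        (1# + 1#) + (- u + u)        ≈⟨ +-congˡ (-‿inverseˡ u) ⟩
        (1# + 1#) + 0#               ≈⟨ +-assoc 1# 1# 0# ⟩
        2 × 1#                       ∎

    factor-coeff-< : ∀ i → i < n → factor n i ℚx.≈ 1# i
    factor-coeff-< i i<n = ℚx.trans (expand i) (ℚx.trans (⊕-coeff (geom n) (geom n * u) i)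
      (ℚx.trans (ℚx.+-congˡ (⊛q^-coeff-< (geom n) n i i<n)) (ℚx.trans (ℚx.+-identityʳ _) (geom-coeff-< m i i<n))))
      where
      expand : factor n ≈ geom n + geom n * u
      expand = trans (*-congˡ (sym geom≈inverse)) (trans (*-comm _ _)
                 (trans (distribˡ (geom n) 1# u) (+-congʳ (*-identityʳ _))))

  Π : ℕ → ℚ⟦x⟧⟦q⟧.Series
  Π N = ⟦ prodUpTo N ⟧

  Π-suc : ∀ N → Π (suc N) ≈ Π N * factor (suc N)
  Π-suc N = trans (⟦*S⟧ (prodUpTo N) ((oneS +S qPow (suc N)) *S invS (oneS -S qPow (suc N))))
              (*-congˡ (trans (⟦*S⟧ (oneS +S qPow (suc N)) (invS (oneS -S qPow (suc N))))
              (*-congʳ (trans (⟦+S⟧ oneS (qPow (suc N))) (+-cong ⟦oneS⟧ (⟦qPow⟧ (suc N)))))))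

  logDerivativeSum : ℕ → ℚ⟦x⟧⟦q⟧.Series
  logDerivativeSum N = ∑q.∑< N (factorLogDerivative ∘ suc)

  θ-Π : ∀ N → θ (Π N) ≈ logDerivativeSum N * Π N
  θ-Π zero = begin
    θ (Π 0)                     ≈⟨ θ-cong ⟦oneS⟧ ⟩
    θ 1#                        ≈⟨ θ-κ ℚx.1# ⟩
    0#                          ≈⟨ zeroˡ (Π 0) ⟨
    0# * Π 0                    ∎
  θ-Π (suc N) = begin
    θ (Π (suc N))                                          ≈⟨ θ-cong (Π-suc N) ⟩
    θ (Π N * f)                                            ≈⟨ θ-⊛ (Π N) f ⟩
    θ (Π N) * f + Π N * θ f                                ≈⟨ +-cong (*-congʳ (θ-Π N)) (*-congˡ (θ-factor N)) ⟩
    (logDerivativeSum N * Π N) * f + Π N * (t * f)         ≈⟨ +-cong (*-assoc _ _ _) (x∙yz≈y∙xz _ _ _) ⟩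
    logDerivativeSum N * (Π N * f) + t * (Π N * f)         ≈⟨ distribʳ _ _ _ ⟨
    (logDerivativeSum N + t) * (Π N * f)                   ≈⟨ *-congˡ (Π-suc N) ⟨
    logDerivativeSum (suc N) * Π (suc N)                   ∎
    where
    f t : ℚ⟦x⟧⟦q⟧.Series
    f = factor (suc N)
    t = factorLogDerivative (suc N)


module OverpartitionCoefficients where

  open import Defs
  open import Data.Nat as ℕ using (ℕ; zero; suc; _∸_; _≤_; _≤?_; s≤s) renaming (_+_ to _+ℕ_; _*_ to _*ℕ_)
  import Data.Nat.Properties as ℕ
  open import Data.Nat.Divisibility using (_∣_; _∣?_)
  open import Data.Integer using (+_)
  open import Data.Rational as ℚ using ()
  open import Relation.Nullary using (Dec; yes; no)
  open import Relation.Binary.PropositionalEquality as ≡ using ()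
  import Algebra.Properties.Semiring.Mult

  open SeriesCoefficients
  open OverpartitionProduct
  open OddCofactorDivisors using (oddMultipleWeight; select; σOddCofactor; σOddCofactor-extend; σbar≡2*σOddCofactor)
  open FiniteSum ℕ.+-*-commutativeSemiring using () renaming (∑< to ∑ℕ<; *-distribˡ-∑ to *-distribˡ-∑ℕ)
  open CommutativeRing ℚ⟦x⟧⟦q⟧.seriesRing
  open ℚ⟦x⟧⟦q⟧ using (θ; q^_; geom; ⊕-coeff; ⊛q^-coeff-<; ⊛q^-coeff-≥; ⊛-cong≤; ×-coeff)
  private module ℚx = CommutativeRing ℚ⟦x⟧.seriesRing
  private module ℚxMult = Algebra.Properties.Semiring.Mult ℚx.semiring
  private module ∑q = FiniteSum commutativeSemiring
  open import Relation.Binary.Reasoning.Setoid ℚx.setoid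

  σbarSeries : ℚ⟦x⟧⟦q⟧.Series
  σbarSeries i = ℚ⟦x⟧.κ (+ σbar i ℚ./ 1)

  Π-stable : ∀ N i → i ≤ N → Π (suc N) i ℚx.≈ Π N i
  Π-stable N i i≤N = ℚx.trans (Π-suc N i)
    (ℚx.trans (⊛-cong≤ N (λ _ _ → ℚx.refl) (λ j j≤N → factor-coeff-< N j (s≤s j≤N)) i i≤N) (*-identityʳ (Π N) i))

  Π-coeff : ∀ N i → i ≤ N → Π N i ℚx.≈ Π i i
  Π-coeff N i i≤N = ≡.subst (λ M → Π M i ℚx.≈ Π i i) (ℕ.m∸n+n≡m i≤N) (go (N ∸ i))
    where
    go : ∀ k → Π (k +ℕ i) i ℚx.≈ Π i i
    go zero    = ℚx.refl
    go (suc k) = ℚx.trans (Π-stable (k +ℕ i) i (ℕ.m≤n+m i k)) (go k)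

  factorLogDerivative-coeff : ∀ n i → factorLogDerivative n i ℚx.≈ (2 *ℕ oddMultipleWeight n i) ℚxMult.× ℚx.1#
  factorLogDerivative-coeff n i = ℚx.trans (×-coeff (2 *ℕ n) _ i) (ℚx.trans (ℚxMult.×-congʳ (2 *ℕ n) (*-comm (q^ n) _ i))
                                    (weight (n ≤? i)))
    where
    weight : (n≤?i : Dec (n ≤ i)) →
      (2 *ℕ n) ℚxMult.× (geom (2 *ℕ n) * q^ n) i ℚx.≈ (2 *ℕ select n≤?i (select (2 *ℕ n ∣? (i ∸ n)) n)) ℚxMult.× ℚx.1#
    weight (no n≰i)  = ℚx.trans (ℚxMult.×-congʳ (2 *ℕ n) (⊛q^-coeff-< _ n i (ℕ.≰⇒> n≰i))) (ℚ⟦x⟧⟦q⟧.×-zeroʳ (2 *ℕ n))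
    weight (yes n≤i) = ℚx.trans (ℚxMult.×-congʳ (2 *ℕ n) (⊛q^-coeff-≥ _ n i n≤i)) (divides (2 *ℕ n ∣? (i ∸ n)))
      where
      divides : (d : Dec (2 *ℕ n ∣ i ∸ n)) → (2 *ℕ n) ℚxMult.× ℚ⟦x⟧⟦q⟧.indicator d ℚx.≈ (2 *ℕ select d n) ℚxMult.× ℚx.1#
      divides (yes _) = ℚx.refl
      divides (no _)  = ℚ⟦x⟧⟦q⟧.×-zeroʳ (2 *ℕ n)

  ∑q-coeff : ∀ N fs i → ∑q.∑< N fs i ℚx.≈ ℚ⟦x⟧⟦q⟧.∑< N (λ j → fs j i)
  ∑q-coeff zero    fs i = ℚx.refl
  ∑q-coeff (suc N) fs i = ℚx.trans (⊕-coeff (∑q.∑< N fs) (fs N) i) (ℚx.+-congʳ (∑q-coeff N fs i))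

  logDerivativeSum-coeff : ∀ N i → i ≤ N → logDerivativeSum N i ℚx.≈ σbarSeries i
  logDerivativeSum-coeff N i i≤N = begin
    logDerivativeSum N i
      ≈⟨ ∑q-coeff N _ i ⟩
    ℚ⟦x⟧⟦q⟧.∑< N (λ j → factorLogDerivative (suc j) i)
      ≈⟨ ℚ⟦x⟧⟦q⟧.∑-cong N (λ j → factorLogDerivative-coeff (suc j) i) ⟩
    ℚ⟦x⟧⟦q⟧.∑< N (λ j → (2 *ℕ oddMultipleWeight (suc j) i) ℚxMult.× ℚx.1#)
      ≈⟨ ∑-× N _ ⟩
    ∑ℕ< N (λ j → 2 *ℕ oddMultipleWeight (suc j) i) ℚxMult.× ℚx.1#
      ≡⟨ ≡.cong (ℚxMult._× ℚx.1#) (≡.trans (≡.sym (*-distribˡ-∑ℕ N 2 _)) (≡.cong (2 *ℕ_) (σOddCofactor-extend N i i≤N))) ⟩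
    (2 *ℕ σOddCofactor i) ℚxMult.× ℚx.1#
      ≡⟨ ≡.cong (ℚxMult._× ℚx.1#) (≡.sym (σbar≡2*σOddCofactor i)) ⟩
    σbar i ℚxMult.× ℚx.1#
      ≈⟨ ℚ⟦x⟧.×-κ (σbar i) ℚ.1ℚ ⟩
    ℚ⟦x⟧.κ (σbar i RationalArithmetic.× ℚ.1ℚ)
      ≈⟨ ℚ⟦x⟧.κ-cong (RationalArithmetic.×1≡/1 (σbar i)) ⟩
    σbarSeries i ∎
    where
    ∑-× : ∀ N h → ℚ⟦x⟧⟦q⟧.∑< N (λ j → h j ℚxMult.× ℚx.1#) ℚx.≈ ∑ℕ< N h ℚxMult.× ℚx.1#
    ∑-× zero    h = ℚx.refl
    ∑-× (suc N) h = ℚx.trans (ℚx.+-congʳ (∑-× N h)) (ℚx.sym (ℚxMult.×-homo-+ ℚx.1# (∑ℕ< N h) (h N)))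

  overpartitions : ℚ⟦x⟧⟦q⟧.Series
  overpartitions = ⟦ overpartProd ⟧

  -- The coefficient of qⁿ in overpartitions is, by definition, that of the partial product Π n.
  θ-overpartitions : θ overpartitions ≈ σbarSeries * overpartitions
  θ-overpartitions n = ℚx.trans (θ-Π n n) (⊛-cong≤ n (logDerivativeSum-coeff n) (Π-coeff n) n ℕ.≤-refl)

module BinomialPolynomials where

  open import Defs
  open import Data.Nat using (ℕ; suc)
  open import Data.Integer using (+_)
  open import Data.Rational as ℚ using (_/_)
  open PolynomialCoefficients
  open SeriesCoefficients using (coeff-prodP)
  open CommutativeRing ℚ⟦x⟧.seriesRing
  open ℚ⟦x⟧ using (κ; q^_; κ-cong; κ-neg; ×-κ)
  open import Algebra.Properties.Ring ring using (x[y-z]≈xy-xz)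
  open import Algebra.Properties.Semiring.Mult semiring using (_×_; ×-assoc-*; ×-comm-*; ×-congʳ)
  open import Relation.Binary.Reasoning.Setoid setoid

  x : ℚ⟦x⟧.Series
  x = q^ 1

  binomial : ℕ → ℚ⟦x⟧.Series
  binomial k = coeff (binomX k)

  binomial-suc : ∀ k → suc k × binomial (suc k) ≈ binomial k * (x - k × 1#)
  binomial-suc k = begin
    suc k × binomial (suc k)                                 ≈⟨ ×-congʳ (suc k) (coeff-prodP factor k) ⟩
    suc k × (binomial k * coeff (factor k))                  ≈⟨ ×-comm-* (suc k) _ _ ⟨
    binomial k * (suc k × coeff (factor k))                  ≈⟨ *-congˡ (×-congʳ (suc k) (coeff-·P (+ 1 / suc k) shifted)) ⟩
    binomial k * (suc k × (κ (+ 1 / suc k) * coeff shifted)) ≈⟨ *-congˡ (×-assoc-* (suc k) _ _) ⟨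
    binomial k * ((suc k × κ (+ 1 / suc k)) * coeff shifted) ≈⟨ *-congˡ (*-congʳ inverse) ⟩
    binomial k * (1# * coeff shifted)                        ≈⟨ *-congˡ (*-identityˡ _) ⟩
    binomial k * coeff shifted                               ≈⟨ *-congˡ (trans (coeff-+P X (constP (ℚ.- (+ k / 1)))) (+-cong coeff-X linear)) ⟩
    binomial k * (x - k × 1#)                                ∎
    where
    factor : ℕ → Poly
    factor i = (+ 1 / suc i) ·P (X +P constP (ℚ.- (+ i / 1)))
    shifted : Poly
    shifted = X +P constP (ℚ.- (+ k / 1))
    inverse : suc k × κ (+ 1 / suc k) ≈ 1#
    inverse = trans (×-κ (suc k) _) (κ-cong (RationalArithmetic.×-/ k 1))
    linear : coeff (constP (ℚ.- (+ k / 1))) ≈ - (k × 1#)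
    linear = trans (coeff-constP _) (trans (κ-neg _) (-‿cong (sym (trans (×-κ k ℚ.1ℚ) (κ-cong (RationalArithmetic.×1≡/1 k))))))

  binomial-pascal : ∀ k → k × binomial k + suc k × binomial (suc k) ≈ x * binomial k
  binomial-pascal k = begin
    k × binomial k + suc k × binomial (suc k)               ≈⟨ +-congˡ (binomial-suc k) ⟩
    k × binomial k + binomial k * (x - k × 1#)              ≈⟨ +-congˡ (x[y-z]≈xy-xz (binomial k) x (k × 1#)) ⟩
    k × binomial k + (binomial k * x - binomial k * (k × 1#))
                                                            ≈⟨ +-congˡ (+-congˡ (-‿cong (trans (×-comm-* k _ _) (×-congʳ k (*-identityʳ _))))) ⟩
    k × binomial k + (binomial k * x - k × binomial k)      ≈⟨ +-congˡ (+-comm _ _) ⟩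
    k × binomial k + (- (k × binomial k) + binomial k * x)  ≈⟨ +-assoc _ _ _ ⟨
    (k × binomial k - k × binomial k) + binomial k * x      ≈⟨ +-congʳ (-‿inverseʳ _) ⟩
    0# + binomial k * x                                     ≈⟨ +-identityˡ _ ⟩
    binomial k * x                                          ≈⟨ *-comm _ x ⟩
    x * binomial k                                          ∎

module BinomialSeries (F : Defs.Series) (F₀≈1 : SeriesCoefficients.⟦ F ⟧ 0 ℚ⟦x⟧.≋ ℚ⟦x⟧.𝟙) where

  open import Defs hiding (Series)
  open import Data.Nat as ℕ using (ℕ; zero; suc; _≤_; _<_; s≤s)
  import Data.Nat.Properties as ℕ
  open import Function using (_∘_; id)
  open import Relation.Binary.PropositionalEquality as ≡ using ()
  open PolynomialCoefficients using (coeff-*P)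
  open SeriesCoefficients
  open BinomialPolynomials using (x; binomial; binomial-pascal)
  open CommutativeRing ℚ⟦x⟧⟦q⟧.seriesRing
  open ℚ⟦x⟧⟦q⟧ using (Series; θ; θ-cong; θ-⊛; θ-⊕; θ-κ; κ; κ-+; κ-*; κ-cong; κ⊛; ×-κ; ⊕-coeff; ⊝-coeff;
                      ⊛-cong≤; ⊛-vanishes)
  private module ℚx = CommutativeRing ℚ⟦x⟧.seriesRing
  import Algebra.Properties.Semiring.Mult
  private module ℚxMult = Algebra.Properties.Semiring.Mult ℚx.semiring
  private module ∑q = FiniteSum commutativeSemiring
  open import Algebra.Properties.Semiring.Exp semiring using (_^_; ^-congˡ)
  open import Algebra.Properties.Ring ring using (-0#≈0#)
  open import Algebra.Properties.Semiring.Mult semiring using (_×_; ×-assoc-*; ×-comm-*; ×-congʳ)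
  open import Algebra.Properties.CommutativeSemigroup *-commutativeSemigroup using (x∙yz≈y∙xz)
  open import Relation.Binary.Reasoning.Setoid setoid

  H : Series
  H = ⟦ F ⟧ - 1#

  H₀≈0 : H 0 ℚx.≈ ℚx.0#
  H₀≈0 = ℚx.trans (⊕-coeff ⟦ F ⟧ (- 1#) 0)
    (ℚx.trans (ℚx.+-congˡ (⊝-coeff 1# 0)) (ℚx.trans (ℚx.+-congʳ F₀≈1) (ℚx.-‿inverseʳ ℚx.1#)))

  H^-vanishes : ∀ k i → i < k → (H ^ k) i ℚx.≈ ℚx.0#
  H^-vanishes (suc k) i i<1+k = ⊛-vanishes 1 k H (H ^ k) H₀ (H^-vanishes k) i i<1+k
    where
    H₀ : ∀ j → j < 1 → H j ℚx.≈ ℚx.0#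
    H₀ zero    _          = H₀≈0
    H₀ (suc j) (s≤s ())

  G : Series
  G = ⟦ powX F ⟧

  partialSum : ℕ → Series
  partialSum M = ∑q.∑< M (λ k → κ (binomial k) * H ^ k)

  partialSum-coeff : ∀ M n → partialSum M n ℚx.≈ ℚ⟦x⟧⟦q⟧.∑< M (λ k → binomial k ℚx.* (H ^ k) n)
  partialSum-coeff zero    n = ℚx.refl
  partialSum-coeff (suc M) n = ℚx.trans (⊕-coeff (partialSum M) _ n) (ℚx.+-cong (partialSum-coeff M n) (κ⊛ (binomial M) (H ^ M) n))

  G-coeff : ∀ n → G n ℚx.≈ ℚ⟦x⟧⟦q⟧.∑< (suc n) (λ k → binomial k ℚx.* (H ^ k) n)
  G-coeff n = ℚx.trans (ℚx.reflexive (≡.cong (coeff ∘ sumP) (map-applyUpTo term id (suc n))))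
    (ℚx.trans (coeff-sumP term (suc n)) (ℚ⟦x⟧⟦q⟧.∑-cong (suc n) λ k →
      ℚx.trans (coeff-*P (binomX k) (((F -S oneS) ^S k) n)) (ℚx.*-congˡ (power k))))
    where
    term : ℕ → Poly
    term k = binomX k *P ((F -S oneS) ^S k) n
    power : ∀ k → ⟦ (F -S oneS) ^S k ⟧ n ℚx.≈ (H ^ k) n
    power k = ℚx.trans (⟦^S⟧ (F -S oneS) k n) (^-congˡ k (trans (⟦-S⟧ F oneS) (+-congˡ (-‿cong ⟦oneS⟧))) n)

  G≈partialSum : ∀ M n → n < M → G n ℚx.≈ partialSum M n
  G≈partialSum M n n<M = ℚx.trans (G-coeff n) (ℚx.trans (ℚx.sym (ℚ⟦x⟧⟦q⟧.∑-extend (suc n) M _ n<M vanish))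
                           (ℚx.sym (partialSum-coeff M n)))
    where
    vanish : ∀ k → suc n ≤ k → binomial k ℚx.* (H ^ k) n ℚx.≈ ℚx.0#
    vanish k n<k = ℚx.trans (ℚx.*-congˡ (H^-vanishes k n n<k)) (ℚx.zeroʳ (binomial k))

  θ-H^ : ∀ k → θ (H ^ suc k) ≈ (suc k × H ^ k) * θ H
  θ-H^ zero = begin
    θ (H * 1#)                       ≈⟨ θ-⊛ H 1# ⟩
    θ H * 1# + H * θ 1#              ≈⟨ +-cong (*-identityʳ (θ H)) (*-congˡ (θ-κ ℚx.1#)) ⟩
    θ H + H * 0#                     ≈⟨ +-congˡ (zeroʳ H) ⟩
    θ H + 0#                         ≈⟨ +-identityʳ (θ H) ⟩
    θ H                              ≈⟨ *-identityˡ (θ H) ⟨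
    1# * θ H                         ≈⟨ *-congʳ (+-identityʳ 1#) ⟨
    (1 × H ^ 0) * θ H                ∎
  θ-H^ (suc k) = begin
    θ (H * H ^ suc k)                              ≈⟨ θ-⊛ H (H ^ suc k) ⟩
    θ H * H ^ suc k + H * θ (H ^ suc k)            ≈⟨ +-cong (*-comm (θ H) _) (*-congˡ (θ-H^ k)) ⟩
    H ^ suc k * θ H + H * ((suc k × H ^ k) * θ H)  ≈⟨ +-congˡ (*-assoc H _ (θ H)) ⟨
    H ^ suc k * θ H + (H * (suc k × H ^ k)) * θ H  ≈⟨ +-congˡ (*-congʳ (×-comm-* (suc k) H (H ^ k))) ⟩
    H ^ suc k * θ H + (suc k × H ^ suc k) * θ H    ≈⟨ distribʳ (θ H) _ _ ⟨
    (suc (suc k) × H ^ suc k) * θ H                ∎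

  -- The formal derivative of the binomial partial sum with respect to H.
  partialSum′ : ℕ → Series
  partialSum′ M = ∑q.∑< M (λ k → κ (suc k ℚxMult.× binomial (suc k)) * H ^ k)

  θ-partialSum : ∀ M → θ (partialSum (suc M)) ≈ θ H * partialSum′ M
  θ-partialSum zero = begin
    θ (0# + κ (binomial 0) * 1#)                              ≈⟨ θ-⊕ 0# _ ⟩
    θ 0# + θ (κ (binomial 0) * 1#)                            ≈⟨ +-cong ℚ⟦x⟧⟦q⟧.×-zeroʳ (θ-cong (*-identityʳ _)) ⟩
    0# + θ (κ (binomial 0))                                   ≈⟨ +-congˡ (θ-κ (binomial 0)) ⟩
    0# + 0#                                                   ≈⟨ +-identityʳ 0# ⟩
    0#                                                        ≈⟨ zeroʳ (θ H) ⟨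
    θ H * 0#                                                  ∎
  θ-partialSum (suc M) = begin
    θ (partialSum (suc M) + c * H ^ suc M)                    ≈⟨ θ-⊕ (partialSum (suc M)) _ ⟩
    θ (partialSum (suc M)) + θ (c * H ^ suc M)                ≈⟨ +-cong (θ-partialSum M) (θ-⊛ c (H ^ suc M)) ⟩
    θ H * partialSum′ M + (θ c * H ^ suc M + c * θ (H ^ suc M))
                                                              ≈⟨ +-congˡ (+-cong (*-congʳ (θ-κ _)) (*-congˡ (θ-H^ M))) ⟩
    θ H * partialSum′ M + (0# * H ^ suc M + c * ((suc M × H ^ M) * θ H))
                                                              ≈⟨ +-congˡ (trans (+-congʳ (zeroˡ _)) (+-identityˡ _)) ⟩
    θ H * partialSum′ M + c * ((suc M × H ^ M) * θ H)         ≈⟨ +-congˡ reorder ⟩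
    θ H * partialSum′ M + θ H * (κ (suc M ℚxMult.× binomial (suc M)) * H ^ M)
                                                              ≈⟨ distribˡ (θ H) _ _ ⟨
    θ H * partialSum′ (suc M)                                 ∎
    where
    c : Series
    c = κ (binomial (suc M))
    reorder : c * ((suc M × H ^ M) * θ H) ≈ θ H * (κ (suc M ℚxMult.× binomial (suc M)) * H ^ M)
    reorder = begin
      c * ((suc M × H ^ M) * θ H)                    ≈⟨ *-congˡ (*-comm _ (θ H)) ⟩
      c * (θ H * (suc M × H ^ M))                    ≈⟨ x∙yz≈y∙xz c (θ H) _ ⟩
      θ H * (c * (suc M × H ^ M))                    ≈⟨ *-congˡ (×-comm-* (suc M) c (H ^ M)) ⟩
      θ H * (suc M × (c * H ^ M))                    ≈⟨ *-congˡ (×-assoc-* (suc M) c (H ^ M)) ⟨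
      θ H * ((suc M × c) * H ^ M)                    ≈⟨ *-congˡ (*-congʳ (×-κ (suc M) (binomial (suc M)))) ⟩
      θ H * (κ (suc M ℚxMult.× binomial (suc M)) * H ^ M) ∎

  partialSum′-identity : ∀ M → (1# + H) * partialSum′ M ≈ κ x * partialSum M + κ (M ℚxMult.× binomial M) * H ^ M
  partialSum′-identity zero = begin
    (1# + H) * 0#                                    ≈⟨ zeroʳ _ ⟩
    0#                                               ≈⟨ +-identityʳ 0# ⟨
    0# + 0#                                          ≈⟨ +-cong (zeroʳ (κ x)) (trans (*-congʳ ℚ⟦x⟧⟦q⟧.κ-0) (zeroˡ 1#)) ⟨
    κ x * 0# + κ ℚx.0# * 1#                           ∎
  partialSum′-identity (suc M) = begin
    (1# + H) * (partialSum′ M + a * p)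
      ≈⟨ distribˡ (1# + H) _ _ ⟩
    (1# + H) * partialSum′ M + (1# + H) * (a * p)
      ≈⟨ +-cong (partialSum′-identity M) (trans (distribʳ _ 1# H) (+-congʳ (*-identityˡ _))) ⟩
    (κ x * partialSum M + b * p) + (a * p + H * (a * p))
      ≈⟨ +-assoc _ _ _ ⟩
    κ x * partialSum M + (b * p + (a * p + H * (a * p)))
      ≈⟨ +-congˡ (+-assoc _ _ _) ⟨
    κ x * partialSum M + ((b * p + a * p) + H * (a * p))
      ≈⟨ +-congˡ (+-congʳ (trans (sym (distribʳ p b a)) (*-congʳ pascal))) ⟩
    κ x * partialSum M + ((κ x * κ (binomial M)) * p + H * (a * p))
      ≈⟨ +-congˡ (+-cong (*-assoc _ _ _) (x∙yz≈y∙xz H a p)) ⟩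
    κ x * partialSum M + (κ x * (κ (binomial M) * p) + a * (H * p))
      ≈⟨ +-assoc _ _ _ ⟨
    (κ x * partialSum M + κ x * (κ (binomial M) * p)) + a * H ^ suc M
      ≈⟨ +-congʳ (distribˡ (κ x) _ _) ⟨
    κ x * partialSum (suc M) + a * H ^ suc M ∎
    where
    p a b : Series
    p = H ^ M
    a = κ (suc M ℚxMult.× binomial (suc M))
    b = κ (M ℚxMult.× binomial M)
    pascal : b + a ≈ κ x * κ (binomial M)
    pascal = trans (sym (κ-+ _ _)) (trans (κ-cong (binomial-pascal M)) (κ-* x (binomial M)))

  θH≈θF : θ H ≈ θ ⟦ F ⟧
  θH≈θF = trans (θ-⊕ ⟦ F ⟧ (- 1#)) (trans (+-congˡ (trans (ℚ⟦x⟧⟦q⟧.θ-neg 1#) (trans (-‿cong (θ-κ ℚx.1#)) -0#≈0#)))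
            (+-identityʳ _))

  -- Comparing coefficients of q^n only involves the binomial terms with k ≤ n.
  θ-power : ⟦ F ⟧ * θ G ≈ κ x * θ ⟦ F ⟧ * G
  θ-power n = ℚx.trans truncate (ℚx.trans (ℚx.trans expand (ℚx.trans (⊕-coeff _ _ n) (ℚx.+-cong tail≈G high≈0)))
                (ℚx.trans (ℚx.+-identityʳ _) (rearrange n)))
    where
    M : ℕ
    M = suc n
    F≈1+H : ⟦ F ⟧ ≈ 1# + H
    F≈1+H = sym (trans (+-comm 1# H) (trans (+-assoc ⟦ F ⟧ (- 1#) 1#) (trans (+-congˡ (-‿inverseˡ 1#)) (+-identityʳ ⟦ F ⟧))))
    truncate : (⟦ F ⟧ * θ G) n ℚx.≈ ((1# + H) * θ (partialSum (suc M))) n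
    truncate = ⊛-cong≤ n (λ i _ → F≈1+H i)
      (λ i i≤n → ℚxMult.×-congʳ i (G≈partialSum (suc M) i (s≤s (ℕ.m≤n⇒m≤1+n i≤n)))) n ℕ.≤-refl
    expand : ((1# + H) * θ (partialSum (suc M))) n ℚx.≈ (θ H * (κ x * partialSum M) + θ H * (κ (M ℚxMult.× binomial M) * H ^ M)) n
    expand = trans (*-congˡ (θ-partialSum M)) (trans (x∙yz≈y∙xz (1# + H) (θ H) _)
               (trans (*-congˡ (partialSum′-identity M)) (distribˡ (θ H) _ _))) n
    tail≈G : (θ H * (κ x * partialSum M)) n ℚx.≈ (θ H * (κ x * G)) n
    tail≈G = ⊛-cong≤ n (λ _ _ → ℚx.refl) (λ i i≤n → ℚx.trans (κ⊛ x (partialSum M) i)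
      (ℚx.trans (ℚx.*-congˡ (ℚx.sym (G≈partialSum M i (s≤s i≤n)))) (ℚx.sym (κ⊛ x G i)))) n ℕ.≤-refl
    high≈0 : (θ H * (κ (M ℚxMult.× binomial M) * H ^ M)) n ℚx.≈ ℚx.0#
    high≈0 = ⊛-vanishes 0 M (θ H) _ (λ _ ()) (λ i i<M → ℚx.trans (κ⊛ _ (H ^ M) i)
      (ℚx.trans (ℚx.*-congˡ (H^-vanishes M i i<M)) (ℚx.zeroʳ _))) n ℕ.≤-refl
    rearrange : θ H * (κ x * G) ≈ κ x * θ ⟦ F ⟧ * G
    rearrange = trans (*-congʳ θH≈θF) (trans (sym (*-assoc _ _ G)) (*-congʳ (*-comm _ (κ x))))

module PbarRecurrence where

  open import Defs
  open import Data.Nat using (ℕ; zero; suc; _∸_; s≤s)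
  import Data.Nat.Properties as ℕ
  open import Data.Integer using (+_)
  open import Data.Rational using (_/_)
  open import Relation.Binary.PropositionalEquality as ≡ using (_≡_)
  open PolynomialCoefficients
  open SeriesCoefficients
  open OverpartitionCoefficients using (σbarSeries)
  open BinomialPolynomials using (x)
  open CommutativeRing ℚ⟦x⟧.seriesRing
  open ℚ⟦x⟧ using (κ; κ-0; κ-cong; ×-κ)
  open ℚ⟦x⟧⟦q⟧ using (∑<; ∑-shift; ∑-cong<; θ)
  private module Q = CommutativeRing ℚ⟦x⟧⟦q⟧.seriesRing
  open import Algebra.Properties.Semiring.Mult semiring using (_×_; ×-assoc-*; ×-congʳ)
  open import Relation.Binary.Reasoning.Setoid setoid

  Pb : ℚ⟦x⟧⟦q⟧.Series
  Pb = ⟦ Pbar ⟧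

  K : ℚ⟦x⟧⟦q⟧.Series
  K = ℚ⟦x⟧⟦q⟧.κ x Q.* σbarSeries

  σbarSeries₀≈0 : σbarSeries 0 ≈ 0#
  σbarSeries₀≈0 = κ-0

  K₀≈0 : K 0 ≈ 0#
  K₀≈0 = trans (ℚ⟦x⟧⟦q⟧.κ⊛ x σbarSeries 0) (trans (*-congˡ σbarSeries₀≈0) (zeroʳ x))

  K-coeff : ∀ f n → (K Q.* f) n ≈ x * ∑< n (λ j → σbarSeries (suc j) * f (n ∸ suc j))
  K-coeff f n = begin
    (K Q.* f) n                                              ≈⟨ Q.*-assoc (ℚ⟦x⟧⟦q⟧.κ x) σbarSeries f n ⟩
    (ℚ⟦x⟧⟦q⟧.κ x Q.* (σbarSeries Q.* f)) n                   ≈⟨ ℚ⟦x⟧⟦q⟧.κ⊛ x _ n ⟩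
    x * (σbarSeries Q.* f) n                                 ≈⟨ *-congˡ (ℚ⟦x⟧⟦q⟧.⊛-coeff σbarSeries f n) ⟩
    x * ∑< (suc n) (λ i → σbarSeries i * f (n ∸ i))          ≈⟨ *-congˡ (∑-shift n _) ⟩
    x * (σbarSeries 0 * f n + ∑< n (λ j → σbarSeries (suc j) * f (n ∸ suc j)))
                                                             ≈⟨ *-congˡ (+-congʳ (trans (*-congʳ σbarSeries₀≈0) (zeroˡ (f n)))) ⟩
    x * (0# + ∑< n (λ j → σbarSeries (suc j) * f (n ∸ suc j)))
                                                             ≈⟨ *-congˡ (+-identityˡ _) ⟩
    x * ∑< n (λ j → σbarSeries (suc j) * f (n ∸ suc j))      ∎

  Pbar-recurrence : ∀ n → Pb (suc n) ≈ (κ (+ 1 / suc n) * x) * ∑< (suc n) (λ j → σbarSeries (suc j) * Pb (n ∸ j))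
  Pbar-recurrence n = recurrence _ (λ _ _ → ≡.refl)
    where
    recurrence : ∀ step →
      (∀ n prev → step (suc n) prev ≡ ((+ 1 / suc n) ·P X) *P sumFrom1 (suc n) (λ k → (+ σbar k / 1) ·P prev (suc n ∸ k))) →
      coeff (strongRec step (suc n)) ≈ (κ (+ 1 / suc n) * x) * ∑< (suc n) (λ j → σbarSeries (suc j) * coeff (strongRec step (n ∸ j)))
    recurrence step step-suc = begin
      coeff (strongRec step (suc n))
        ≈⟨ reflexive (≡.cong coeff (≡.trans (strongRec-unfold step (suc n)) (step-suc n prev))) ⟩
      coeff (((+ 1 / suc n) ·P X) *P sumFrom1 (suc n) terms)
        ≈⟨ coeff-*P ((+ 1 / suc n) ·P X) (sumFrom1 (suc n) terms) ⟩
      coeff ((+ 1 / suc n) ·P X) * coeff (sumFrom1 (suc n) terms)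
        ≈⟨ *-cong (trans (coeff-·P (+ 1 / suc n) X) (*-congˡ coeff-X)) (coeff-sumFrom1 (suc n) terms) ⟩
      (κ (+ 1 / suc n) * x) * ∑< (suc n) (λ j → coeff (terms (suc j)))
        ≈⟨ *-congˡ (∑-cong< (suc n) λ j j<1+n → trans (coeff-·P _ (prev (n ∸ j)))
             (*-congˡ (reflexive (≡.cong coeff (nth-table step (suc n) (n ∸ j) (s≤s (ℕ.m∸n≤m n j))))))) ⟩
      (κ (+ 1 / suc n) * x) * ∑< (suc n) (λ j → σbarSeries (suc j) * coeff (strongRec step (n ∸ j))) ∎
      where
      prev : ℕ → Poly
      prev = nth (table step (suc n))
      terms : ℕ → Poly
      terms k = (+ σbar k / 1) ·P prev (suc n ∸ k)

  θ-Pbar : θ Pb Q.≈ K Q.* Pb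
  θ-Pbar zero    = sym (trans (K-coeff Pb 0) (zeroʳ x))
  θ-Pbar (suc n) = begin
    suc n × Pb (suc n)                                 ≈⟨ ×-congʳ (suc n) (Pbar-recurrence n) ⟩
    suc n × ((κ (+ 1 / suc n) * x) * Σ)                ≈⟨ ×-assoc-* (suc n) _ Σ ⟨
    (suc n × (κ (+ 1 / suc n) * x)) * Σ                ≈⟨ *-congʳ (×-assoc-* (suc n) _ x) ⟨
    ((suc n × κ (+ 1 / suc n)) * x) * Σ                ≈⟨ *-congʳ (*-congʳ (trans (×-κ (suc n) _) (κ-cong (RationalArithmetic.×-/ n 1)))) ⟩
    (1# * x) * Σ                                       ≈⟨ *-congʳ (*-identityˡ x) ⟩
    x * Σ                                              ≈⟨ K-coeff Pb (suc n) ⟨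
    (K Q.* Pb) (suc n)                                 ∎
    where
    Σ : ℚ⟦x⟧.Series
    Σ = ∑< (suc n) (λ j → σbarSeries (suc j) * Pb (n ∸ j))

module GeneratingFunction where

  open import Defs
  open PolynomialCoefficients using (coeff-1P)
  open SeriesCoefficients
  open OverpartitionCoefficients using (σbarSeries; overpartitions; θ-overpartitions)
  open BinomialPolynomials using (x)
  open BinomialSeries overpartProd coeff-1P using (G; θ-power; G-coeff)
  open PbarRecurrence using (Pb; K; K₀≈0; θ-Pbar)
  open CommutativeRing ℚ⟦x⟧⟦q⟧.seriesRing
  open ℚ⟦x⟧⟦q⟧ using (θ; κ; θ-solution-unique)
  open RationalArithmetic using (ℚ⟦x⟧-torsionFree)
  private module ℚx = CommutativeRing ℚ⟦x⟧.seriesRing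
  open import Algebra.Properties.CommutativeSemigroup *-commutativeSemigroup using (xy∙z≈y∙xz)
  open import Relation.Binary.Reasoning.Setoid setoid

  θ-G : θ G ≈ K * G
  θ-G = begin
    θ G                                        ≈⟨ *-identityˡ (θ G) ⟨
    1# * θ G                                   ≈⟨ *-congʳ (trans (*-comm W F) F*W≈1) ⟨
    (W * F) * θ G                              ≈⟨ *-assoc W F (θ G) ⟩
    W * (F * θ G)                              ≈⟨ *-congˡ θ-power ⟩
    W * ((κ x * θ F) * G)                      ≈⟨ *-congˡ (*-congʳ (*-congˡ θ-overpartitions)) ⟩
    W * ((κ x * (σbarSeries * F)) * G)         ≈⟨ *-congˡ (*-congʳ (sym (*-assoc (κ x) σbarSeries F))) ⟩
    W * ((K * F) * G)                          ≈⟨ *-congˡ (xy∙z≈y∙xz K F G) ⟩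
    W * (F * (K * G))                          ≈⟨ *-assoc W F _ ⟨
    (W * F) * (K * G)                          ≈⟨ *-congʳ (trans (*-comm W F) F*W≈1) ⟩
    1# * (K * G)                               ≈⟨ *-identityˡ _ ⟩
    K * G                                      ∎
    where
    F W : ℚ⟦x⟧⟦q⟧.Series
    F = overpartitions
    W = ⟦ invS overpartProd ⟧
    F*W≈1 : F * W ≈ 1#
    F*W≈1 = ⟦invS⟧ overpartProd coeff-1P

  G≈Pb : G ≈ Pb
  G≈Pb = θ-solution-unique ℚ⟦x⟧-torsionFree K₀≈0 G₀≈Pb₀ (trans θ-G (sym (+-identityˡ _))) (trans θ-Pbar (sym (+-identityˡ _)))
    where
    G₀≈Pb₀ : G 0 ℚx.≈ Pb 0
    G₀≈Pb₀ = ℚx.trans (G-coeff 0) (ℚx.trans (ℚx.+-identityˡ _) (ℚx.*-identityʳ _))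

module DerivativeInX where

  open import Defs
  open import Data.Nat using (zero; suc)
  open import Data.Integer using (+_)
  open import Data.Rational as ℚ using (_/_)
  open OverpartitionCoefficients using (σbarSeries)
  open BinomialPolynomials using (x)
  open PbarRecurrence using (Pb; K; K₀≈0; θ-Pbar; σbarSeries₀≈0)
  open RationalArithmetic using (ℚ⟦x⟧-torsionFree)
  open CommutativeRing ℚ⟦x⟧⟦q⟧.seriesRing
  open ℚ⟦x⟧⟦q⟧ using (θ; θ-⊛; κ; κ-cong; θ-solution-unique; ⊛-coeff)
  open ℚ⟦x⟧⟦q⟧.Lift ℚ⟦x⟧.∂-isDerivation
    renaming (lift to ∂ₓ; lift-isDerivation to ∂ₓ-isDerivation; lift-θ to ∂ₓ-θ; lift-κ to ∂ₓ-κ)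
  open IsDerivation ∂ₓ-isDerivation using (leibniz) renaming (cong to ∂ₓ-cong)
  private module ℚx = CommutativeRing ℚ⟦x⟧.seriesRing
  open import Algebra.Properties.CommutativeSemigroup *-commutativeSemigroup using (x∙yz≈y∙xz)
  open import Relation.Binary.Reasoning.Setoid setoid

  σbarOverSeries : ℚ⟦x⟧⟦q⟧.Series
  σbarOverSeries i = ℚ⟦x⟧.κ (σbarOver i)

  θ-σbarOverSeries : θ σbarOverSeries ≈ σbarSeries
  θ-σbarOverSeries zero    = ℚx.sym σbarSeries₀≈0
  θ-σbarOverSeries (suc j) = ℚx.trans (ℚ⟦x⟧.×-κ (suc j) _) (ℚ⟦x⟧.κ-cong (RationalArithmetic.×-/ j (σbar (suc j))))

  ∂ₓ-K : ∂ₓ K ≈ σbarSeries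
  ∂ₓ-K = begin
    ∂ₓ (κ x * σbarSeries)                          ≈⟨ leibniz (κ x) σbarSeries ⟩
    ∂ₓ (κ x) * σbarSeries + κ x * ∂ₓ σbarSeries    ≈⟨ +-cong (*-congʳ ∂ₓ-κx) (*-congˡ ∂ₓ-σbarSeries) ⟩
    1# * σbarSeries + κ x * 0#                     ≈⟨ +-cong (*-identityˡ _) (zeroʳ _) ⟩
    σbarSeries + 0#                                ≈⟨ +-identityʳ _ ⟩
    σbarSeries                                     ∎
    where
    ∂ₓ-κx : ∂ₓ (κ x) ≈ 1#
    ∂ₓ-κx = trans (∂ₓ-κ x) (κ-cong ℚ⟦x⟧.∂-q)
    ∂ₓ-σbarSeries : ∂ₓ σbarSeries ≈ 0#
    ∂ₓ-σbarSeries i = ℚ⟦x⟧.∂-κ (+ σbar i / 1)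

  θ-∂ₓPb : θ (∂ₓ Pb) ≈ σbarSeries * Pb + K * ∂ₓ Pb
  θ-∂ₓPb = begin
    θ (∂ₓ Pb)                      ≈⟨ ∂ₓ-θ Pb ⟨
    ∂ₓ (θ Pb)                      ≈⟨ ∂ₓ-cong θ-Pbar ⟩
    ∂ₓ (K * Pb)                    ≈⟨ leibniz K Pb ⟩
    ∂ₓ K * Pb + K * ∂ₓ Pb          ≈⟨ +-congʳ (*-congʳ ∂ₓ-K) ⟩
    σbarSeries * Pb + K * ∂ₓ Pb    ∎

  θ-σbarOverSeries*Pb : θ (σbarOverSeries * Pb) ≈ σbarSeries * Pb + K * (σbarOverSeries * Pb)
  θ-σbarOverSeries*Pb = begin
    θ (σbarOverSeries * Pb)                                 ≈⟨ θ-⊛ σbarOverSeries Pb ⟩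
    θ σbarOverSeries * Pb + σbarOverSeries * θ Pb           ≈⟨ +-cong (*-congʳ θ-σbarOverSeries) (*-congˡ θ-Pbar) ⟩
    σbarSeries * Pb + σbarOverSeries * (K * Pb)             ≈⟨ +-congˡ (x∙yz≈y∙xz σbarOverSeries K Pb) ⟩
    σbarSeries * Pb + K * (σbarOverSeries * Pb)             ∎

  ∂ₓPb≈σbarOverSeries*Pb : ∂ₓ Pb ≈ σbarOverSeries * Pb
  ∂ₓPb≈σbarOverSeries*Pb = θ-solution-unique ℚ⟦x⟧-torsionFree K₀≈0 ∂ₓPb₀≈ θ-∂ₓPb θ-σbarOverSeries*Pb
    where
    ∂ₓPb₀≈ : ∂ₓ Pb 0 ℚx.≈ (σbarOverSeries * Pb) 0
    ∂ₓPb₀≈ = ℚx.trans (ℚ⟦x⟧.∂-κ ℚ.1ℚ) (ℚx.sym (ℚx.trans (⊛-coeff σbarOverSeries Pb 0)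
               (ℚx.trans (ℚx.+-identityˡ _) (ℚx.trans (ℚx.*-congʳ ℚ⟦x⟧.κ-0) (ℚx.zeroˡ _)))))

module CoefficientFormulas where

  open import Defs
  open import Data.Nat using (suc; _∸_)
  open PolynomialCoefficients using (coeff-·P; coeff-deriv)
  open SeriesCoefficients using (coeff-sumFrom1)
  open PbarRecurrence using (Pb)
  open DerivativeInX using (∂ₓPb≈σbarOverSeries*Pb; σbarOverSeries)
  open CommutativeRing ℚ⟦x⟧.seriesRing
  open ℚ⟦x⟧⟦q⟧ using (∑<; ∑-shift; ∑-cong; ⊛-coeff)
  open import Relation.Binary.Reasoning.Setoid setoid

  Pbar≈powX : ∀ n → Pbar n ≈P powX overpartProd n
  Pbar≈powX n = sym (GeneratingFunction.G≈Pb n)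

  deriv-Pbar : ∀ n → deriv (Pbar n) ≈P sumFrom1 n (λ k → σbarOver k ·P Pbar (n ∸ k))
  deriv-Pbar n = begin
    coeff (deriv (Pbar n))
      ≈⟨ coeff-deriv (Pbar n) ⟩
    ℚ⟦x⟧.∂ (Pb n)
      ≈⟨ ∂ₓPb≈σbarOverSeries*Pb n ⟩
    (σbarOverSeries ℚ⟦x⟧⟦q⟧.⊛ Pb) n
      ≈⟨ ⊛-coeff σbarOverSeries Pb n ⟩
    ∑< (suc n) (λ i → σbarOverSeries i * Pb (n ∸ i))
      ≈⟨ ∑-shift n _ ⟩
    σbarOverSeries 0 * Pb n + ∑< n (λ j → σbarOverSeries (suc j) * Pb (n ∸ suc j))
      ≈⟨ +-congʳ (trans (*-congʳ ℚ⟦x⟧.κ-0) (zeroˡ (Pb n))) ⟩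
    0# + ∑< n (λ j → σbarOverSeries (suc j) * Pb (n ∸ suc j))
      ≈⟨ +-identityˡ _ ⟩
    ∑< n (λ j → σbarOverSeries (suc j) * Pb (n ∸ suc j))
      ≈⟨ ∑-cong n (λ j → coeff-·P (σbarOver (suc j)) (Pbar (n ∸ suc j))) ⟨
    ∑< n (λ j → coeff (σbarOver (suc j) ·P Pbar (n ∸ suc j)))
      ≈⟨ coeff-sumFrom1 n (λ k → σbarOver k ·P Pbar (n ∸ k)) ⟨
    coeff (sumFrom1 n (λ k → σbarOver k ·P Pbar (n ∸ k))) ∎

open import Defs
open import Data.Nat using (ℕ; suc; _≤_; _∸_)
open import Data.Product using (_×_; _,_)
open CoefficientFormulas using (Pbar≈powX; deriv-Pbar)

-- The derivative formula holds for n = 0 as well.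
theorem1p5 : ((n : ℕ) → Pbar n ≈P powX overpartProd n)
             × ((n : ℕ) → 1 ≤ n → deriv (Pbar n) ≈P sumFrom1 n (λ k → σbarOver k ·P Pbar (n ∸ k)))
theorem1p5 = Pbar≈powX , (λ n _ → deriv-Pbar n)
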